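{- Every well-typed term of $\lambda^{hc}$ is strongly normalizing: if $\Delta;\Gamma\vdash M:A\mid s$, then there is no infinite reduction sequence $M\to M_1\to M_2\to\cdots$ in $\lambda^{hc}$.
   Context: The calculus $\lambda^{hc}$. Simple variables $a,b,\dots$ and audited variables $u,v,\dots$ form disjoint sets. Labels $\psi\in\{\mathsf{refl},\mathsf{trans},\beta,\beta_\Box,\mathsf{ti},\mathsf{lam},\mathsf{app},\mathsf{let},\mathsf{trpl}_{[]},\mathsf{trpl}_{::},\mathsf{d}\}$. Types $A,B,C ::= P \mid A\supset B \mid [\![s]\!]A$; codes $s,t,r ::= a \mid u \mid \lambda a^A.s \mid (s\,t) \mid\ !s \mid \mathsf{let}(u^A:=s,t) \mid \mathsf{TI}(\theta)$ ($\theta$ finite map labels$\to$codes); trails $q ::= \mathsf{refl}(s) \mid \mathsf{trans}(q,q') \mid \beta(a^A.s,t) \mid \beta_\Box(s,u^A.t) \mid \mathsf{ti}(q,\theta) \mid \mathsf{lam}(a^A.q) \mid \mathsf{app}(q,q') \mid \mathsf{let}(q,u^A.q') \mid \mathsf{trpl}(\zeta)$ ($\zeta$ finite ordered map labels$\to$trails); terms $M,N,R,S ::= a \mid u \mid \lambda a^A.M \mid (M\,N) \mid\ !_q M \mid \mathsf{let}(u^A:=M,N) \mid \mathsf{TI}(\vartheta)$ ($\vartheta$ finite map labels$\to$terms). Binding as usual ($\lambda$ binds $a$, $\mathsf{let}$ binds $u$ in its second argument, in trails the variable before a dot), up to $\alpha$-equivalence. Substitutions: on codes (and terms) $s[t/a]$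 / $M[N/a]$ is capture-avoiding, pointwise on inspection maps, and does not enter boxes ($(!s)[t/a]=\,!s$, $(!_qM)[N/a]=\,!_qM$); $s[t/u]$ on codes is capture-avoiding and enters boxes; both extend to types and trails. $q\theta$ (and analogously the term $q\vartheta$): if the head label of $q$ ($\mathsf{trpl}_{[]}$/$\mathsf{trpl}_{::}$ for $\mathsf{trpl}(\zeta)$ with $\zeta$ empty/nonempty) is not in $\mathrm{dom}(\theta)$ then $\theta(\mathsf{d})$; otherwise $\mathsf{refl},\beta,\beta_\Box,\mathsf{ti}$ give $\theta$ of their label; $\mathsf{trans}(q_1,q_2)\theta=\theta(\mathsf{trans})(q_1\theta)(q_2\theta)$, same for $\mathsf{app}$ and $\mathsf{let}(q_1,u^A.q_2)$; $\mathsf{lam}(a^A.q_1)\theta=\theta(\mathsf{lam})(q_1\theta)$; $\mathsf{trpl}(\{\})\theta=\theta(\mathsf{trpl}_{[]})$; $\mathsf{trpl}(\{q_1/\psi_1,\vec{q'/\psi'}\})\theta=\theta(\mathsf{trpl}_{::})(q_1\theta)(\mathsf{trpl}(\{\vec{q'/\psi'}\})\theta)$. $\mathrm{src}$/$\mathrm{tgt}$ of trails: $\mathsf{refl}(s)\mapsto s/s$; $\mathsf{trans}(q_1,q_2)\mapsto\mathrm{src}(q_1)/\mathrm{tgt}(q_2)$; $\beta(a^A.s,t)\mapsto(\lambda a^A.s)t\,/\,s[t/a]$; $\beta_\Box(s,u^A.t)\mapsto\mathsf{let}(u^A:=\,!s,t)\,/\,t[s/u]$; $\mathsf{ti}(q,\theta)\mapsto\mathsf{TI}(\theta)/q\theta$;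 both commute with $\mathsf{lam},\mathsf{app},\mathsf{let},\mathsf{trpl}$. $\mathcal T^B(\psi)=B$ for $\psi\in\{\mathsf{d},\mathsf{refl},\beta,\beta_\Box,\mathsf{ti},\mathsf{trpl}_{[]}\}$, $B\supset B$ for $\mathsf{lam}$, $B\supset B\supset B$ for $\mathsf{trans},\mathsf{app},\mathsf{let},\mathsf{trpl}_{::}$. Typing. Codes $\Delta;\Gamma\vdash s:A$: variables from $\Gamma$ ($a:A$) or $\Delta$ ($u::A$); $\lambda a^A.s:A\supset B$ if $\Delta;\Gamma,a:A\vdash s:B$; $s\,t:B$ if $s:A\supset B,t:A$; $\Delta;\Gamma\vdash\,!t:[\![t]\!]A$ if $\Delta;\cdot\vdash t:A$; $\mathsf{let}(u^A:=s,t):C[r/u]$ if $s:[\![r]\!]A$ and $\Delta,u::A;\Gamma\vdash t:C$; $\mathsf{TI}(\theta):B$ if $\mathsf{d}\in\mathrm{dom}(\theta)$ and $\Delta;\cdot\vdash\theta(\psi):\mathcal T^B(\psi)$ for all $\psi\in\mathrm{dom}(\theta)$. Trails $\Delta;\Gamma\vdash q:s\mathrel{\overset{\triangleright}{=}}_A t$: $\mathsf{refl}(s):s\mathrel{\overset{\triangleright}{=}}_A s$ if $s:A$; $\mathsf{trans}(q_1,q_2):r\mathrel{\overset{\triangleright}{=}}_A t$ if $q_1:r\mathrel{\overset{\triangleright}{=}}_A s$, $q_2:s\mathrel{\overset{\triangleright}{=}}_A t$; $\beta(a^A.s,t):(\lambda a^A.s)t\mathrel{\overset{\triangleright}{=}}_B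 s[t/a]$ if $\Delta;\Gamma,a:A\vdash s:B$, $t:A$; $\beta_\Box(s,u^A.t):\mathsf{let}(u^A:=\,!s,t)\mathrel{\overset{\triangleright}{=}}_{C[s/u]}t[s/u]$ if $\Delta;\cdot\vdash s:A$, $\Delta,u::A;\Gamma\vdash t:C$; $\mathsf{ti}(q,\theta):\mathsf{TI}(\theta)\mathrel{\overset{\triangleright}{=}}_B q\theta$ if $\mathsf{d}\in\mathrm{dom}(\theta)$, $\Delta;\cdot\vdash q:s\mathrel{\overset{\triangleright}{=}}_A t$, $\Delta;\cdot\vdash\theta(\psi):\mathcal T^B(\psi)$; $\mathsf{lam}(a^A.q):\lambda a^A.s\mathrel{\overset{\triangleright}{=}}_{A\supset B}\lambda a^A.t$ if $\Delta;\Gamma,a:A\vdash q:s\mathrel{\overset{\triangleright}{=}}_B t$; $\mathsf{app}(q_1,q_2):s_1s_2\mathrel{\overset{\triangleright}{=}}_B t_1t_2$ if $q_1:s_1\mathrel{\overset{\triangleright}{=}}_{A\supset B}t_1$, $q_2:s_2\mathrel{\overset{\triangleright}{=}}_A t_2$; $\mathsf{let}(q_1,u^A.q_2):\mathsf{let}(u^A:=s_1,s_2)\mathrel{\overset{\triangleright}{=}}_{C[r/u]}\mathsf{let}(u^A:=t_1,t_2)$ if $q_1:s_1\mathrel{\overset{\triangleright}{=}}_{[\![r]\!]A}t_1$, $\Delta,u::A;\Gamma\vdash q_2:s_2\mathrel{\overset{\triangleright}{=}}_C t_2$; $\mathsf{trpl}(\zeta):\mathsf{TI}(\theta)\mathrel{\overset{\triangleright}{=}}_B\mathsf{TI}(\theta')$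 if $\mathsf{d}\in\mathrm{dom}(\zeta)=\mathrm{dom}(\theta)=\mathrm{dom}(\theta')$ and $\Delta;\cdot\vdash\zeta(\psi):\theta(\psi)\mathrel{\overset{\triangleright}{=}}_{\mathcal T^B(\psi)}\theta'(\psi)$. Terms $\Delta;\Gamma\vdash M:A\mid s$: $a:A\mid a$, $u:A\mid u$ from the contexts; $\lambda a^A.M:A\supset B\mid\lambda a^A.s$ if $\Delta;\Gamma,a:A\vdash M:B\mid s$; $M\,N:B\mid s\,t$ if $M:A\supset B\mid s$, $N:A\mid t$; $\Delta;\Gamma\vdash\,!_qM:[\![s]\!]A\mid\,!s$ if $\Delta;\cdot\vdash M:A\mid t$ and $\Delta;\cdot\vdash q:s\mathrel{\overset{\triangleright}{=}}_A t$; $\mathsf{let}(u^A:=M,N):C[r/u]\mid\mathsf{let}(u^A:=s,t)$ if $M:[\![r]\!]A\mid s$, $\Delta,u::A;\Gamma\vdash N:C\mid t$; $\mathsf{TI}(\vartheta):B\mid\mathsf{TI}(\theta)$ if $\mathsf{d}\in\mathrm{dom}(\vartheta)=\mathrm{dom}(\theta)$ and $\Delta;\cdot\vdash\vartheta(\psi):\mathcal T^B(\psi)\mid\theta(\psi)$. $\mathrm{code}(M)$ replaces every $!_qN$ by $!\,\mathrm{src}(q)$ (homomorphically otherwise). Audited substitution on terms, with $\delta=[u\mapsto(N,q,t)]$ and $\delta'=[t/u]$ on codes; the trail $M\times\delta$ and the term $M\ltimes\delta$: $a\times\delta=\mathsf{refl}(a)$, $u\times\delta=q$, $v\times\delta=\mathsf{refl}(v)$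 ($v\ne u$), $(\lambda a^A.R)\times\delta=\mathsf{lam}(a^A.R\times\delta)$, $(R\,S)\times\delta=\mathsf{app}(R\times\delta,S\times\delta)$, $(!_{q'}R)\times\delta=\mathsf{refl}(!(\mathrm{src}(q')\delta'))$, $\mathsf{let}(v^A:=R,S)\times\delta=\mathsf{let}(R\times\delta,v^A.S\times\delta)$, $\mathsf{TI}(\vartheta)\times\delta=\mathsf{trpl}(\vartheta\times\delta)$ pointwise; $a\ltimes\delta=a$, $u\ltimes\delta=N$, $v\ltimes\delta=v$, $(\lambda a^A.R)\ltimes\delta=\lambda a^A.(R\ltimes\delta)$, $(R\,S)\ltimes\delta=(R\ltimes\delta)(S\ltimes\delta)$, $(!_{q'}R)\ltimes\delta=\,!_{\mathsf{trans}(q'\delta',R\times\delta)}(R\ltimes\delta)$, $\mathsf{let}(v^A:=R,S)\ltimes\delta=\mathsf{let}(v^A:=R\ltimes\delta,S\ltimes\delta)$, $\mathsf{TI}(\vartheta)\ltimes\delta=\mathsf{TI}(\vartheta\ltimes\delta)$ pointwise (bound variables chosen fresh for $u,N,q,t$). Box-free contexts $\mathcal F ::= \blacksquare \mid \lambda a^A.\mathcal F \mid \mathcal F\,M \mid M\,\mathcal F \mid \mathsf{let}(u^A:=\mathcal F,M)\mid\mathsf{let}(u^A:=M,\mathcal F)\mid\mathsf{TI}(\{\vec{M/\psi},\mathcal F/\psi',\vec{N/\psi''}\})$, with associated trail contexts $\mathcal Q_\blacksquare=\blacksquare$, $\mathcal Q_{\mathcal F\,M}=\mathsf{app}(\mathcal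 Q_{\mathcal F},\mathsf{refl}(\mathrm{code}(M)))$, $\mathcal Q_{M\,\mathcal F}=\mathsf{app}(\mathsf{refl}(\mathrm{code}(M)),\mathcal Q_{\mathcal F})$, $\mathcal Q_{\lambda a^A.\mathcal F}=\mathsf{lam}(a^A.\mathcal Q_{\mathcal F})$, $\mathcal Q_{\mathsf{let}(u^A:=\mathcal F,M)}=\mathsf{let}(\mathcal Q_{\mathcal F},u^A.\mathsf{refl}(\mathrm{code}(M)))$, $\mathcal Q_{\mathsf{let}(u^A:=M,\mathcal F)}=\mathsf{let}(\mathsf{refl}(\mathrm{code}(M)),u^A.\mathcal Q_{\mathcal F})$, $\mathcal Q_{\mathsf{TI}(\{\vec{M/\psi},\mathcal F/\psi',\vec{N/\psi''}\})}=\mathsf{trpl}(\{\vec{\mathsf{refl}(\mathrm{code}(M))/\psi},\mathcal Q_{\mathcal F}/\psi',\vec{\mathsf{refl}(\mathrm{code}(N))/\psi''}\})$. Reduction $\to$ relates terms of the form $!_qM$ and is generated by: $!_q\mathcal F[(\lambda a^A.M)N]\to\,!_{\mathsf{trans}(q,\mathcal Q_{\mathcal F}[\beta(a^A.\mathrm{code}(M),\mathrm{code}(N))])}\mathcal F[M[N/a]]$; $!_q\mathcal F[\mathsf{let}(u^A:=\,!_{q'}M,N)]\to\,!_{q_f}\mathcal F[N\ltimes[u\mapsto(M,q',\mathrm{src}(q'))]]$ with $q_f=\mathsf{trans}(q,\mathcal Q_{\mathcal F}[\mathsf{trans}(\beta_\Box(\mathrm{src}(q'),u^A.\mathrm{code}(N)),N\times[u\mapsto(M,q',\mathrm{src}(q'))])])$;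 $!_q\mathcal F[\mathsf{TI}(\vartheta)]\to\,!_{\mathsf{trans}(q,\mathcal Q_{\mathcal F}[\mathsf{ti}(q,\mathrm{code}\circ\vartheta)])}\mathcal F[q\vartheta]$; and if $M\to N$ then $!_q\mathcal F[M]\to\,!_q\mathcal F[N]$. -}

module Defs where

open import Data.Nat using (ℕ; zero; suc)
open import Data.Fin using (Fin; zero; suc)
open import Data.Vec using (Vec; []; _∷_; lookup; _[_]≔_) renaming (map to vmap)
open import Data.Maybe using (Maybe; just; nothing) renaming (map to mmap)
open import Data.Product using (Σ; _×_; _,_; ∃)
open import Data.Sum using (_⊎_; inj₁; inj₂)
open import Function using (id; _∘_)
open import Relation.Binary.PropositionalEquality using (_≡_)

-- Labels and finite maps (a finite map is a vector of optional entries,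
-- one slot per label, in the canonical order of the labels below; this
-- order is also the order of the "ordered maps" ζ).

data Label : Set where
  ℓrefl ℓtrans ℓβ ℓβ□ ℓti ℓlam ℓapp ℓlet ℓtrpl[] ℓtrpl∷ ℓd : Label

ix : Label → Fin 11
ix ℓrefl   = zero
ix ℓtrans  = suc zero
ix ℓβ      = suc (suc zero)
ix ℓβ□     = suc (suc (suc zero))
ix ℓti     = suc (suc (suc (suc zero)))
ix ℓlam    = suc (suc (suc (suc (suc zero))))
ix ℓapp    = suc (suc (suc (suc (suc (suc zero)))))
ix ℓlet    = suc (suc (suc (suc (suc (suc (suc zero))))))
ix ℓtrpl[] = suc (suc (suc (suc (suc (suc (suc (suc zero)))))))
ix ℓtrpl∷  = suc (suc (suc (suc (suc (suc (suc (suc (suc zero))))))))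
ix ℓd      = suc (suc (suc (suc (suc (suc (suc (suc (suc (suc zero)))))))))

Map : Set → Set
Map X = Vec (Maybe X) 11

infixl 9 _!!_
_!!_ : ∀ {X : Set} → Map X → Label → Maybe X
θ !! ψ = lookup θ (ix ψ)

-- Syntax (de Bruijn; Code n m has n simple and m audited variables in
-- scope).  Contents of boxes and of inspection maps are typed in Δ;·,
-- hence are syntactically closed w.r.t. simple variables (scope 0).

variable
  n m n' m' k : ℕ

infixr 7 _⊃_

mutual
  data Type : ℕ → Set where
    atom : ℕ → Type m
    _⊃_  : Type m → Type m → Type m
    ⟦_⟧_ : Code 0 m → Type m → Type m

  data Code : ℕ → ℕ → Set where
    cvar  : Fin n → Code n m
    cuvar : Fin m → Code n m
    clam  : Type m → Code (suc n) m → Code n m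
    capp  : Code n m → Code n m → Code n m
    cbox  : Code 0 m → Code n m
    clet  : Type m → Code n m → Code n (suc m) → Code n m
    cTI   : Map (Code 0 m) → Code n m

data Trail : ℕ → ℕ → Set where
  trefl  : Code n m → Trail n m
  ttrans : Trail n m → Trail n m → Trail n m
  tβ     : Type m → Code (suc n) m → Code n m → Trail n m
  tβ□    : Code 0 m → Type m → Code n (suc m) → Trail n m
  tti    : Trail 0 m → Map (Code 0 m) → Trail n m
  tlam   : Type m → Trail (suc n) m → Trail n m
  tapp   : Trail n m → Trail n m → Trail n m
  tlet   : Trail n m → Type m → Trail n (suc m) → Trail n m
  ttrpl  : Map (Trail 0 m) → Trail n m

data Term : ℕ → ℕ → Set where
  var  : Fin n → Term n m
  uvar : Fin m → Term n m
  lam  : Type m → Term (suc n) m → Term n m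
  app  : Term n m → Term n m → Term n m
  box  : Trail 0 m → Term 0 m → Term n m
  mlet : Type m → Term n m → Term n (suc m) → Term n m
  TI   : Map (Term 0 m) → Term n m

ext : (Fin n → Fin n') → Fin (suc n) → Fin (suc n')
ext ρ zero    = zero
ext ρ (suc i) = suc (ρ i)

mutual
  renT : (Fin m → Fin m') → Type m → Type m'
  renT ρ (atom p)  = atom p
  renT ρ (A ⊃ B)   = renT ρ A ⊃ renT ρ B
  renT ρ (⟦ s ⟧ A) = ⟦ renC id ρ s ⟧ renT ρ A

  renC : (Fin n → Fin n') → (Fin m → Fin m') → Code n m → Code n' m'
  renC ρs ρa (cvar i)    = cvar (ρs i)
  renC ρs ρa (cuvar i)   = cuvar (ρa i)
  renC ρs ρa (clam A s)  = clam (renT ρa A) (renC (ext ρs) ρa s)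
  renC ρs ρa (capp s t)  = capp (renC ρs ρa s) (renC ρs ρa t)
  renC ρs ρa (cbox s)    = cbox (renC id ρa s)
  renC ρs ρa (clet A s t) = clet (renT ρa A) (renC ρs ρa s) (renC ρs (ext ρa) t)
  renC ρs ρa (cTI θ)     = cTI (renCM ρa θ)

  renCM : (Fin m → Fin m') → Vec (Maybe (Code 0 m)) k → Vec (Maybe (Code 0 m')) k
  renCM ρ []             = []
  renCM ρ (nothing ∷ θ)  = nothing ∷ renCM ρ θ
  renCM ρ (just c ∷ θ)   = just (renC id ρ c) ∷ renCM ρ θ

mutual
  renTr : (Fin n → Fin n') → (Fin m → Fin m') → Trail n m → Trail n' m'
  renTr ρs ρa (trefl s)      = trefl (renC ρs ρa s)
  renTr ρs ρa (ttrans q q')  = ttrans (renTr ρs ρa q) (renTr ρs ρa q')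
  renTr ρs ρa (tβ A s t)     = tβ (renT ρa A) (renC (ext ρs) ρa s) (renC ρs ρa t)
  renTr ρs ρa (tβ□ s A t)    = tβ□ (renC id ρa s) (renT ρa A) (renC ρs (ext ρa) t)
  renTr ρs ρa (tti q θ)      = tti (renTr id ρa q) (renCM ρa θ)
  renTr ρs ρa (tlam A q)     = tlam (renT ρa A) (renTr (ext ρs) ρa q)
  renTr ρs ρa (tapp q q')    = tapp (renTr ρs ρa q) (renTr ρs ρa q')
  renTr ρs ρa (tlet q A q')  = tlet (renTr ρs ρa q) (renT ρa A) (renTr ρs (ext ρa) q')
  renTr ρs ρa (ttrpl ζ)      = ttrpl (renTrM ρa ζ)

  renTrM : (Fin m → Fin m') → Vec (Maybe (Trail 0 m)) k → Vec (Maybe (Trail 0 m')) k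
  renTrM ρ []            = []
  renTrM ρ (nothing ∷ ζ) = nothing ∷ renTrM ρ ζ
  renTrM ρ (just q ∷ ζ)  = just (renTr id ρ q) ∷ renTrM ρ ζ

mutual
  renTm : (Fin n → Fin n') → (Fin m → Fin m') → Term n m → Term n' m'
  renTm ρs ρa (var i)      = var (ρs i)
  renTm ρs ρa (uvar i)     = uvar (ρa i)
  renTm ρs ρa (lam A M)    = lam (renT ρa A) (renTm (ext ρs) ρa M)
  renTm ρs ρa (app M N)    = app (renTm ρs ρa M) (renTm ρs ρa N)
  renTm ρs ρa (box q M)    = box (renTr id ρa q) (renTm id ρa M)
  renTm ρs ρa (mlet A M N) = mlet (renT ρa A) (renTm ρs ρa M) (renTm ρs (ext ρa) N)
  renTm ρs ρa (TI ϑ)       = TI (renTmM ρa ϑ)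

  renTmM : (Fin m → Fin m') → Vec (Maybe (Term 0 m)) k → Vec (Maybe (Term 0 m')) k
  renTmM ρ []            = []
  renTmM ρ (nothing ∷ ϑ) = nothing ∷ renTmM ρ ϑ
  renTmM ρ (just M ∷ ϑ)  = just (renTm id ρ M) ∷ renTmM ρ ϑ

wk0C : Code 0 m → Code n m
wk0C = renC (λ ()) id

wk0Tr : Trail 0 m → Trail n m
wk0Tr = renTr (λ ()) id

wk0Tm : Term 0 m → Term n m
wk0Tm = renTm (λ ()) id

-- Substitution on types and codes (simultaneous; simple substitution
-- does not enter boxes / inspection maps / types, whose contents are
-- closed w.r.t. simple variables; audited substitution enters everything)

liftSC : (Fin n → Code n' m) → Fin (suc n) → Code (suc n') m
liftSC σ zero    = cvar zero
liftSC σ (suc i) = renC suc id (σ i)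

liftAC : (Fin m → Code 0 m') → Fin (suc m) → Code 0 (suc m')
liftAC σ zero    = cuvar zero
liftAC σ (suc i) = renC id suc (σ i)

mutual
  subT : (Fin m → Code 0 m') → Type m → Type m'
  subT σ (atom p)  = atom p
  subT σ (A ⊃ B)   = subT σ A ⊃ subT σ B
  subT σ (⟦ s ⟧ A) = ⟦ subC (λ ()) σ s ⟧ subT σ A

  subC : (Fin n → Code n' m') → (Fin m → Code 0 m') → Code n m → Code n' m'
  subC σs σa (cvar i)     = σs i
  subC σs σa (cuvar i)    = wk0C (σa i)
  subC σs σa (clam A s)   = clam (subT σa A) (subC (liftSC σs) σa s)
  subC σs σa (capp s t)   = capp (subC σs σa s) (subC σs σa t)
  subC σs σa (cbox s)     = cbox (subC (λ ()) σa s)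
  subC σs σa (clet A s t) = clet (subT σa A) (subC σs σa s)
                                 (subC (λ i → renC id suc (σs i)) (liftAC σa) t)
  subC σs σa (cTI θ)      = cTI (subCM σa θ)

  subCM : (Fin m → Code 0 m') → Vec (Maybe (Code 0 m)) k → Vec (Maybe (Code 0 m')) k
  subCM σ []            = []
  subCM σ (nothing ∷ θ) = nothing ∷ subCM σ θ
  subCM σ (just c ∷ θ)  = just (subC (λ ()) σ c) ∷ subCM σ θ

mutual
  subTr : (Fin n → Code n' m') → (Fin m → Code 0 m') → Trail n m → Trail n' m'
  subTr σs σa (trefl s)     = trefl (subC σs σa s)
  subTr σs σa (ttrans q q') = ttrans (subTr σs σa q) (subTr σs σa q')
  subTr σs σa (tβ A s t)    = tβ (subT σa A) (subC (liftSC σs) σa s) (subC σs σa t)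
  subTr σs σa (tβ□ s A t)   = tβ□ (subC (λ ()) σa s) (subT σa A)
                                  (subC (λ i → renC id suc (σs i)) (liftAC σa) t)
  subTr σs σa (tti q θ)     = tti (subTr (λ ()) σa q) (subCM σa θ)
  subTr σs σa (tlam A q)    = tlam (subT σa A) (subTr (liftSC σs) σa q)
  subTr σs σa (tapp q q')   = tapp (subTr σs σa q) (subTr σs σa q')
  subTr σs σa (tlet q A q') = tlet (subTr σs σa q) (subT σa A)
                                   (subTr (λ i → renC id suc (σs i)) (liftAC σa) q')
  subTr σs σa (ttrpl ζ)     = ttrpl (subTrM σa ζ)

  subTrM : (Fin m → Code 0 m') → Vec (Maybe (Trail 0 m)) k → Vec (Maybe (Trail 0 m')) k
  subTrM σ []            = []
  subTrM σ (nothing ∷ ζ) = nothing ∷ subTrM σ ζ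
  subTrM σ (just q ∷ ζ)  = just (subTr (λ ()) σ q) ∷ subTrM σ ζ

sgS : Code n m → Fin (suc n) → Code n m
sgS t zero    = t
sgS t (suc i) = cvar i

sgA : Code 0 m → Fin (suc m) → Code 0 m
sgA r zero    = r
sgA r (suc i) = cuvar i

_[_/a] : Code (suc n) m → Code n m → Code n m
s [ t /a] = subC (sgS t) cuvar s

_[_/u] : Code n (suc m) → Code 0 m → Code n m
t [ r /u] = subC cvar (sgA r) t

_[_/u]ᵀ : Type (suc m) → Code 0 m → Type m
C [ r /u]ᵀ = subT (sgA r) C

liftSTm : (Fin n → Term n' m) → Fin (suc n) → Term (suc n') m
liftSTm σ zero    = var zero
liftSTm σ (suc i) = renTm suc id (σ i)

subTm : (Fin n → Term n' m) → Term n m → Term n' m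
subTm σ (var i)      = σ i
subTm σ (uvar i)     = uvar i
subTm σ (lam A M)    = lam A (subTm (liftSTm σ) M)
subTm σ (app M N)    = app (subTm σ M) (subTm σ N)
subTm σ (box q M)    = box q M
subTm σ (mlet A M N) = mlet A (subTm σ M) (subTm (λ i → renTm id suc (σ i)) N)
subTm σ (TI ϑ)       = TI ϑ

sgTm : Term n m → Fin (suc n) → Term n m
sgTm N zero    = N
sgTm N (suc i) = var i

_[_/a]ᵐ : Term (suc n) m → Term n m → Term n m
M [ N /a]ᵐ = subTm (sgTm N) M

mutual
  src : Trail n m → Code n m
  src (trefl s)     = s
  src (ttrans q q') = src q
  src (tβ A s t)    = capp (clam A s) t
  src (tβ□ s A t)   = clet A (cbox s) t
  src (tti q θ)     = cTI θ
  src (tlam A q)    = clam A (src q)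
  src (tapp q q')   = capp (src q) (src q')
  src (tlet q A q') = clet A (src q) (src q')
  src (ttrpl ζ)     = cTI (srcM ζ)

  srcM : Vec (Maybe (Trail 0 m)) k → Vec (Maybe (Code 0 m)) k
  srcM []            = []
  srcM (nothing ∷ ζ) = nothing ∷ srcM ζ
  srcM (just q ∷ ζ)  = just (src q) ∷ srcM ζ

mutual
  code : Term n m → Code n m
  code (var i)      = cvar i
  code (uvar i)     = cuvar i
  code (lam A M)    = clam A (code M)
  code (app M N)    = capp (code M) (code N)
  code (box q M)    = cbox (src q)
  code (mlet A M N) = clet A (code M) (code N)
  code (TI ϑ)       = cTI (codeM ϑ)

  codeM : Vec (Maybe (Term 0 m)) k → Vec (Maybe (Code 0 m)) k
  codeM []            = []
  codeM (nothing ∷ ϑ) = nothing ∷ codeM ϑ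
  codeM (just M ∷ ϑ)  = just (code M) ∷ codeM ϑ

-- q θ  and  q ϑ  (partial: undefined when a needed label, including d,
-- is missing from the map)

byLabel : ∀ {X : Set} → Map X → Label → (X → Maybe X) → Maybe X
byLabel θ ψ κ with θ !! ψ
... | just c  = κ c
... | nothing = θ !! ℓd

ap1C : Code n m → Maybe (Code n m) → Maybe (Code n m)
ap1C f (just x) = just (capp f x)
ap1C f nothing  = nothing

ap2C : Code n m → Maybe (Code n m) → Maybe (Code n m) → Maybe (Code n m)
ap2C f (just x) (just y) = just (capp (capp f x) y)
ap2C f _        _        = nothing

mutual
  applyC : ∀ {k'} → Trail n k' → Map (Code 0 m) → Maybe (Code 0 m)
  applyC (trefl s)     θ = byLabel θ ℓrefl just
  applyC (ttrans q q') θ = byLabel θ ℓtrans (λ c → ap2C c (applyC q θ) (applyC q' θ))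
  applyC (tβ A s t)    θ = byLabel θ ℓβ just
  applyC (tβ□ s A t)   θ = byLabel θ ℓβ□ just
  applyC (tti q θ')    θ = byLabel θ ℓti just
  applyC (tlam A q)    θ = byLabel θ ℓlam (λ c → ap1C c (applyC q θ))
  applyC (tapp q q')   θ = byLabel θ ℓapp (λ c → ap2C c (applyC q θ) (applyC q' θ))
  applyC (tlet q A q') θ = byLabel θ ℓlet (λ c → ap2C c (applyC q θ) (applyC q' θ))
  applyC (ttrpl ζ)     θ = applyZC ζ θ

  applyZC : ∀ {k'} → Vec (Maybe (Trail 0 k')) k → Map (Code 0 m) → Maybe (Code 0 m)
  applyZC []            θ = byLabel θ ℓtrpl[] just
  applyZC (nothing ∷ ζ) θ = applyZC ζ θ
  applyZC (just q ∷ ζ)  θ = byLabel θ ℓtrpl∷ (λ c → ap2C c (applyC q θ) (applyZC ζ θ))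

ap1T : Term n m → Maybe (Term n m) → Maybe (Term n m)
ap1T f (just x) = just (app f x)
ap1T f nothing  = nothing

ap2T : Term n m → Maybe (Term n m) → Maybe (Term n m) → Maybe (Term n m)
ap2T f (just x) (just y) = just (app (app f x) y)
ap2T f _        _        = nothing

mutual
  applyTm : ∀ {k'} → Trail n k' → Map (Term 0 m) → Maybe (Term 0 m)
  applyTm (trefl s)     ϑ = byLabel ϑ ℓrefl just
  applyTm (ttrans q q') ϑ = byLabel ϑ ℓtrans (λ c → ap2T c (applyTm q ϑ) (applyTm q' ϑ))
  applyTm (tβ A s t)    ϑ = byLabel ϑ ℓβ just
  applyTm (tβ□ s A t)   ϑ = byLabel ϑ ℓβ□ just
  applyTm (tti q θ)     ϑ = byLabel ϑ ℓti just
  applyTm (tlam A q)    ϑ = byLabel ϑ ℓlam (λ c → ap1T c (applyTm q ϑ))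
  applyTm (tapp q q')   ϑ = byLabel ϑ ℓapp (λ c → ap2T c (applyTm q ϑ) (applyTm q' ϑ))
  applyTm (tlet q A q') ϑ = byLabel ϑ ℓlet (λ c → ap2T c (applyTm q ϑ) (applyTm q' ϑ))
  applyTm (ttrpl ζ)     ϑ = applyZTm ζ ϑ

  applyZTm : ∀ {k'} → Vec (Maybe (Trail 0 k')) k → Map (Term 0 m) → Maybe (Term 0 m)
  applyZTm []            ϑ = byLabel ϑ ℓtrpl[] just
  applyZTm (nothing ∷ ζ) ϑ = applyZTm ζ ϑ
  applyZTm (just q ∷ ζ)  ϑ = byLabel ϑ ℓtrpl∷ (λ c → ap2T c (applyTm q ϑ) (applyZTm ζ ϑ))

-- Audited substitution  M × δ  and  M ⋉ δ.
-- Generalised to a simultaneous audited substitution: each audited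
-- variable is either renamed, or replaced by a triple (N, q, t).

ASub : ℕ → ℕ → Set
ASub m m' = Fin m → Fin m' ⊎ (Term 0 m' × Trail 0 m' × Code 0 m')

liftASub : ASub m m' → ASub (suc m) (suc m')
liftASub δ zero = inj₁ zero
liftASub δ (suc i) with δ i
... | inj₁ j           = inj₁ (suc j)
... | inj₂ (N , q , t) = inj₂ (renTm id suc N , renTr id suc q , renC id suc t)

codeSub : ASub m m' → Fin m → Code 0 m'
codeSub δ i with δ i
... | inj₁ j           = cuvar j
... | inj₂ (N , q , t) = t

sgδ : Term 0 m → Trail 0 m → Code 0 m → ASub (suc m) m
sgδ N q t zero    = inj₂ (N , q , t)
sgδ N q t (suc i) = inj₁ i

uvar× : Fin m' ⊎ (Term 0 m' × Trail 0 m' × Code 0 m') → Trail n m'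
uvar× (inj₁ j)           = trefl (cuvar j)
uvar× (inj₂ (N , q , t)) = wk0Tr q

uvar⋉ : Fin m' ⊎ (Term 0 m' × Trail 0 m' × Code 0 m') → Term n m'
uvar⋉ (inj₁ j)           = uvar j
uvar⋉ (inj₂ (N , q , t)) = wk0Tm N

mutual
  _×ᵟ_ : Term n m → ASub m m' → Trail n m'
  var i      ×ᵟ δ = trefl (cvar i)
  uvar i     ×ᵟ δ = uvar× (δ i)
  lam A R    ×ᵟ δ = tlam (subT (codeSub δ) A) (R ×ᵟ δ)
  app R S    ×ᵟ δ = tapp (R ×ᵟ δ) (S ×ᵟ δ)
  box q R    ×ᵟ δ = trefl (cbox (subC (λ ()) (codeSub δ) (src q)))
  mlet A R S ×ᵟ δ = tlet (R ×ᵟ δ) (subT (codeSub δ) A) (S ×ᵟ liftASub δ)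
  TI ϑ       ×ᵟ δ = ttrpl (timesM ϑ δ)

  timesM : Vec (Maybe (Term 0 m)) k → ASub m m' → Vec (Maybe (Trail 0 m')) k
  timesM []            δ = []
  timesM (nothing ∷ ϑ) δ = nothing ∷ timesM ϑ δ
  timesM (just M ∷ ϑ)  δ = just (M ×ᵟ δ) ∷ timesM ϑ δ

mutual
  _⋉_ : Term n m → ASub m m' → Term n m'
  var i      ⋉ δ = var i
  uvar i     ⋉ δ = uvar⋉ (δ i)
  lam A R    ⋉ δ = lam (subT (codeSub δ) A) (R ⋉ δ)
  app R S    ⋉ δ = app (R ⋉ δ) (S ⋉ δ)
  box q R    ⋉ δ = box (ttrans (subTr (λ ()) (codeSub δ) q) (R ×ᵟ δ)) (R ⋉ δ)
  mlet A R S ⋉ δ = mlet (subT (codeSub δ) A) (R ⋉ δ) (S ⋉ liftASub δ)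
  TI ϑ       ⋉ δ = TI (ltimesM ϑ δ)

  ltimesM : Vec (Maybe (Term 0 m)) k → ASub m m' → Vec (Maybe (Term 0 m')) k
  ltimesM []            δ = []
  ltimesM (nothing ∷ ϑ) δ = nothing ∷ ltimesM ϑ δ
  ltimesM (just M ∷ ϑ)  δ = just (M ⋉ δ) ∷ ltimesM ϑ δ

T : Type m → Label → Type m
T B ℓlam   = B ⊃ B
T B ℓtrans = B ⊃ B ⊃ B
T B ℓapp   = B ⊃ B ⊃ B
T B ℓlet   = B ⊃ B ⊃ B
T B ℓtrpl∷ = B ⊃ B ⊃ B
T B _      = B

wkCtx : Vec (Type m) k → Vec (Type (suc m)) k
wkCtx = vmap (renT suc)

_,,_ : Vec (Type m) m → Type m → Vec (Type (suc m)) (suc m)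
Δ ,, A = renT suc A ∷ wkCtx Δ

infix 4 _⨾_⊢ᶜ_∶_ _⨾_⊢ᵗ_∶_≐_⦂_ _⨾_⊢_∶_∣_

data _⨾_⊢ᶜ_∶_ : Vec (Type m) m → Vec (Type m) n → Code n m → Type m → Set where
  c-var  : ∀ {Δ : Vec (Type m) m} {Γ : Vec (Type m) n} i
         → Δ ⨾ Γ ⊢ᶜ cvar i ∶ lookup Γ i
  c-uvar : ∀ {Δ : Vec (Type m) m} {Γ : Vec (Type m) n} i
         → Δ ⨾ Γ ⊢ᶜ cuvar i ∶ lookup Δ i
  c-lam  : ∀ {Δ : Vec (Type m) m} {Γ : Vec (Type m) n} {A B s}
         → Δ ⨾ (A ∷ Γ) ⊢ᶜ s ∶ B → Δ ⨾ Γ ⊢ᶜ clam A s ∶ A ⊃ B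
  c-app  : ∀ {Δ : Vec (Type m) m} {Γ : Vec (Type m) n} {A B s t}
         → Δ ⨾ Γ ⊢ᶜ s ∶ A ⊃ B → Δ ⨾ Γ ⊢ᶜ t ∶ A → Δ ⨾ Γ ⊢ᶜ capp s t ∶ B
  c-box  : ∀ {Δ : Vec (Type m) m} {Γ : Vec (Type m) n} {A t}
         → Δ ⨾ [] ⊢ᶜ t ∶ A → Δ ⨾ Γ ⊢ᶜ cbox t ∶ ⟦ t ⟧ A
  c-let  : ∀ {Δ : Vec (Type m) m} {Γ : Vec (Type m) n} {A C r s t}
         → Δ ⨾ Γ ⊢ᶜ s ∶ ⟦ r ⟧ A → (Δ ,, A) ⨾ wkCtx Γ ⊢ᶜ t ∶ C
         → Δ ⨾ Γ ⊢ᶜ clet A s t ∶ C [ r /u]ᵀ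
  c-TI   : ∀ {Δ : Vec (Type m) m} {Γ : Vec (Type m) n} {B θ}
         → ∃ (λ c → θ !! ℓd ≡ just c)
         → (∀ ψ c → θ !! ψ ≡ just c → Δ ⨾ [] ⊢ᶜ c ∶ T B ψ)
         → Δ ⨾ Γ ⊢ᶜ cTI θ ∶ B

data _⨾_⊢ᵗ_∶_≐_⦂_ : Vec (Type m) m → Vec (Type m) n → Trail n m → Code n m → Code n m → Type m → Set where
  t-refl  : ∀ {Δ : Vec (Type m) m} {Γ : Vec (Type m) n} {A s}
          → Δ ⨾ Γ ⊢ᶜ s ∶ A → Δ ⨾ Γ ⊢ᵗ trefl s ∶ s ≐ s ⦂ A
  t-trans : ∀ {Δ : Vec (Type m) m} {Γ : Vec (Type m) n} {A q₁ q₂ r s t}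
          → Δ ⨾ Γ ⊢ᵗ q₁ ∶ r ≐ s ⦂ A → Δ ⨾ Γ ⊢ᵗ q₂ ∶ s ≐ t ⦂ A
          → Δ ⨾ Γ ⊢ᵗ ttrans q₁ q₂ ∶ r ≐ t ⦂ A
  t-β     : ∀ {Δ : Vec (Type m) m} {Γ : Vec (Type m) n} {A B s t}
          → Δ ⨾ (A ∷ Γ) ⊢ᶜ s ∶ B → Δ ⨾ Γ ⊢ᶜ t ∶ A
          → Δ ⨾ Γ ⊢ᵗ tβ A s t ∶ capp (clam A s) t ≐ s [ t /a] ⦂ B
  t-β□    : ∀ {Δ : Vec (Type m) m} {Γ : Vec (Type m) n} {A C s t}
          → Δ ⨾ [] ⊢ᶜ s ∶ A → (Δ ,, A) ⨾ wkCtx Γ ⊢ᶜ t ∶ C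
          → Δ ⨾ Γ ⊢ᵗ tβ□ s A t ∶ clet A (cbox s) t ≐ t [ s /u] ⦂ C [ s /u]ᵀ
  t-ti    : ∀ {Δ : Vec (Type m) m} {Γ : Vec (Type m) n} {A B q θ s t r}
          → ∃ (λ c → θ !! ℓd ≡ just c)
          → Δ ⨾ [] ⊢ᵗ q ∶ s ≐ t ⦂ A
          → (∀ ψ c → θ !! ψ ≡ just c → Δ ⨾ [] ⊢ᶜ c ∶ T B ψ)
          → applyC q θ ≡ just r
          → Δ ⨾ Γ ⊢ᵗ tti q θ ∶ cTI θ ≐ wk0C r ⦂ B
  t-lam   : ∀ {Δ : Vec (Type m) m} {Γ : Vec (Type m) n} {A B q s t}
          → Δ ⨾ (A ∷ Γ) ⊢ᵗ q ∶ s ≐ t ⦂ B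
          → Δ ⨾ Γ ⊢ᵗ tlam A q ∶ clam A s ≐ clam A t ⦂ A ⊃ B
  t-app   : ∀ {Δ : Vec (Type m) m} {Γ : Vec (Type m) n} {A B q₁ q₂ s₁ s₂ t₁ t₂}
          → Δ ⨾ Γ ⊢ᵗ q₁ ∶ s₁ ≐ t₁ ⦂ A ⊃ B → Δ ⨾ Γ ⊢ᵗ q₂ ∶ s₂ ≐ t₂ ⦂ A
          → Δ ⨾ Γ ⊢ᵗ tapp q₁ q₂ ∶ capp s₁ s₂ ≐ capp t₁ t₂ ⦂ B
  t-let   : ∀ {Δ : Vec (Type m) m} {Γ : Vec (Type m) n} {A C r q₁ q₂ s₁ s₂ t₁ t₂}
          → Δ ⨾ Γ ⊢ᵗ q₁ ∶ s₁ ≐ t₁ ⦂ ⟦ r ⟧ A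
          → (Δ ,, A) ⨾ wkCtx Γ ⊢ᵗ q₂ ∶ s₂ ≐ t₂ ⦂ C
          → Δ ⨾ Γ ⊢ᵗ tlet q₁ A q₂ ∶ clet A s₁ s₂ ≐ clet A t₁ t₂ ⦂ C [ r /u]ᵀ
  t-trpl  : ∀ {Δ : Vec (Type m) m} {Γ : Vec (Type m) n} {B ζ θ θ'}
          → ∃ (λ q → ζ !! ℓd ≡ just q)
          → (∀ ψ → (ζ !! ψ ≡ nothing × θ !! ψ ≡ nothing × θ' !! ψ ≡ nothing)
                 ⊎ Σ (Trail 0 m) (λ q → Σ (Code 0 m) (λ s → Σ (Code 0 m) (λ t →
                     ζ !! ψ ≡ just q × θ !! ψ ≡ just s × θ' !! ψ ≡ just t
                     × Δ ⨾ [] ⊢ᵗ q ∶ s ≐ t ⦂ T B ψ))))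
          → Δ ⨾ Γ ⊢ᵗ ttrpl ζ ∶ cTI θ ≐ cTI θ' ⦂ B

data _⨾_⊢_∶_∣_ : Vec (Type m) m → Vec (Type m) n → Term n m → Type m → Code n m → Set where
  m-var  : ∀ {Δ : Vec (Type m) m} {Γ : Vec (Type m) n} i
         → Δ ⨾ Γ ⊢ var i ∶ lookup Γ i ∣ cvar i
  m-uvar : ∀ {Δ : Vec (Type m) m} {Γ : Vec (Type m) n} i
         → Δ ⨾ Γ ⊢ uvar i ∶ lookup Δ i ∣ cuvar i
  m-lam  : ∀ {Δ : Vec (Type m) m} {Γ : Vec (Type m) n} {A B M s}
         → Δ ⨾ (A ∷ Γ) ⊢ M ∶ B ∣ s → Δ ⨾ Γ ⊢ lam A M ∶ A ⊃ B ∣ clam A s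
  m-app  : ∀ {Δ : Vec (Type m) m} {Γ : Vec (Type m) n} {A B M N s t}
         → Δ ⨾ Γ ⊢ M ∶ A ⊃ B ∣ s → Δ ⨾ Γ ⊢ N ∶ A ∣ t
         → Δ ⨾ Γ ⊢ app M N ∶ B ∣ capp s t
  m-box  : ∀ {Δ : Vec (Type m) m} {Γ : Vec (Type m) n} {A M q s t}
         → Δ ⨾ [] ⊢ M ∶ A ∣ t → Δ ⨾ [] ⊢ᵗ q ∶ s ≐ t ⦂ A
         → Δ ⨾ Γ ⊢ box q M ∶ ⟦ s ⟧ A ∣ cbox s
  m-let  : ∀ {Δ : Vec (Type m) m} {Γ : Vec (Type m) n} {A C r M N s t}
         → Δ ⨾ Γ ⊢ M ∶ ⟦ r ⟧ A ∣ s → (Δ ,, A) ⨾ wkCtx Γ ⊢ N ∶ C ∣ t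
         → Δ ⨾ Γ ⊢ mlet A M N ∶ C [ r /u]ᵀ ∣ clet A s t
  m-TI   : ∀ {Δ : Vec (Type m) m} {Γ : Vec (Type m) n} {B ϑ θ}
         → ∃ (λ M → ϑ !! ℓd ≡ just M)
         → (∀ ψ → (ϑ !! ψ ≡ nothing × θ !! ψ ≡ nothing)
                 ⊎ Σ (Term 0 m) (λ M → Σ (Code 0 m) (λ s →
                     ϑ !! ψ ≡ just M × θ !! ψ ≡ just s × Δ ⨾ [] ⊢ M ∶ T B ψ ∣ s)))
         → Δ ⨾ Γ ⊢ TI ϑ ∶ B ∣ cTI θ

-- Box-free contexts F : BFCtx n m n' m'  (outer scope n m, hole scope n' m')

data BFCtx : ℕ → ℕ → ℕ → ℕ → Set where
  hole  : BFCtx n m n m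
  lamF  : Type m → BFCtx (suc n) m n' m' → BFCtx n m n' m'
  appL  : BFCtx n m n' m' → Term n m → BFCtx n m n' m'
  appR  : Term n m → BFCtx n m n' m' → BFCtx n m n' m'
  letL  : Type m → BFCtx n m n' m' → Term n (suc m) → BFCtx n m n' m'
  letR  : Type m → Term n m → BFCtx n (suc m) n' m' → BFCtx n m n' m'
  -- TI({M/ψ, F/ψ', N/ψ''}): the map ϑ with the slot of ψ' filled by F
  tiF   : Map (Term 0 m) → Label → BFCtx 0 m n' m' → BFCtx n m n' m'

plug : BFCtx n m n' m' → Term n' m' → Term n m
plug hole         M = M
plug (lamF A F)   M = lam A (plug F M)
plug (appL F N)   M = app (plug F M) N
plug (appR N F)   M = app N (plug F M)
plug (letL A F N) M = mlet A (plug F M) N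
plug (letR A N F) M = mlet A N (plug F M)
plug (tiF ϑ ψ F)  M = TI (ϑ [ ix ψ ]≔ just (plug F M))

qplug : BFCtx n m n' m' → Trail n' m' → Trail n m
qplug hole         q = q
qplug (lamF A F)   q = tlam A (qplug F q)
qplug (appL F N)   q = tapp (qplug F q) (trefl (code N))
qplug (appR N F)   q = tapp (trefl (code N)) (qplug F q)
qplug (letL A F N) q = tlet (qplug F q) A (trefl (code N))
qplug (letR A N F) q = tlet (trefl (code N)) A (qplug F q)
qplug (tiF ϑ ψ F)  q = ttrpl (vmap (mmap (trefl ∘ code)) ϑ [ ix ψ ]≔ just (qplug F q))

ctxRenA : BFCtx n m n' m' → Fin m → Fin m'
ctxRenA hole         = id
ctxRenA (lamF A F)   = ctxRenA F
ctxRenA (appL F N)   = ctxRenA F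
ctxRenA (appR N F)   = ctxRenA F
ctxRenA (letL A F N) = ctxRenA F
ctxRenA (letR A N F) = ctxRenA F ∘ suc
ctxRenA (tiF ϑ ψ F)  = ctxRenA F

-- Reduction (relates terms of the form !_q M)

infix 4 _⟶_

data _⟶_ : Term n m → Term n m → Set where
  r-β   : ∀ {n m n' m'} (q : Trail 0 m) (F : BFCtx 0 m n' m') A M N
        → _⟶_ {n} (box q (plug F (app (lam A M) N)))
                   (box (ttrans q (qplug F (tβ A (code M) (code N))))
                        (plug F (M [ N /a]ᵐ)))
  r-β□  : ∀ {n m n' m'} (q : Trail 0 m) (F : BFCtx 0 m n' m') A q' M N
        → _⟶_ {n} (box q (plug F (mlet A (box q' M) N)))
                   (box (ttrans q (qplug F (ttrans (tβ□ (src q') A (code N))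
                                                    (N ×ᵟ sgδ M q' (src q')))))
                        (plug F (N ⋉ sgδ M q' (src q'))))
  r-ti  : ∀ {n m n' m'} (q : Trail 0 m) (F : BFCtx 0 m n' m') ϑ R
        → applyTm (renTr id (ctxRenA F) q) ϑ ≡ just R
        → _⟶_ {n} (box q (plug F (TI ϑ)))
                   (box (ttrans q (qplug F (tti (renTr id (ctxRenA F) q) (codeM ϑ))))
                        (plug F (wk0Tm R)))
  r-cong : ∀ {n m n' m'} (q : Trail 0 m) (F : BFCtx 0 m n' m') {M N : Term n' m'}
        → M ⟶ N
        → _⟶_ {n} (box q (plug F M)) (box q (plug F N))

-- Erase λhc to an untyped λ-calculus Λ with inspection nodes: a box forgets its
-- trail, let(u := M, N) becomes the redex (λu.N) M, and TI(ϑ) becomes a node τ ϑ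
-- that may reduce to any combination of its entries shaped like an instantiated
-- trail q ϑ.  Every λhc step is then simulated by one step of the erasure, so it
-- suffices that erasures of typed terms are strongly normalising.  This is Tait's
-- reducibility argument for the simple types obtained by forgetting the ⟦ s ⟧
-- modalities: a τ-node is neutral, and its combination reducts are reducible
-- because the entry of each label ψ has type T B ψ.

module Submission where

open import Data.Nat using (ℕ; zero; suc)
open import Data.Fin using (Fin; zero; suc)
open import Data.Vec using (Vec; []; _∷_; lookup; _[_]≔_)
open import Data.Vec.Properties using (lookup-map)
open import Data.Vec.Functional using () renaming ([] to []ᵉ; _∷_ to _∷ᵉ_)
open import Data.Maybe using (Maybe; just; nothing)
open import Data.Product using (Σ; ∃; _×_; _,_)
open import Data.Sum using (_⊎_; inj₁; inj₂)
open import Function using (id; _∘_; flip)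
open import Induction.WellFounded using (Acc; acc)
open import Induction.InfiniteDescent using (InfiniteDescendingSequenceFrom)
open import Relation.Binary.PropositionalEquality
open import Relation.Nullary using (¬_)
open import Defs

data Λ (k : ℕ) : Set where
  #_  : Fin k → Λ k
  ★   : Λ k
  ƛ_  : Λ (suc k) → Λ k
  _·_ : Λ k → Λ k → Λ k
  τ   : Map (Λ k) → Λ k

infixl 8 _·_
infix 9 #_

Entries : ℕ → ℕ → Set
Entries k j = Vec (Maybe (Λ k)) j

private variable
  j k₁ k₂ k₃ : ℕ

mutual
  ren : (Fin k₁ → Fin k₂) → Λ k₁ → Λ k₂
  ren ρ (# i)   = # ρ i
  ren ρ ★       = ★
  ren ρ (ƛ t)   = ƛ ren (ext ρ) t
  ren ρ (t · u) = ren ρ t · ren ρ u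
  ren ρ (τ ϑ)   = τ (renE ρ ϑ)

  renE : (Fin k₁ → Fin k₂) → Entries k₁ j → Entries k₂ j
  renE ρ []            = []
  renE ρ (nothing ∷ ϑ) = nothing ∷ renE ρ ϑ
  renE ρ (just t ∷ ϑ)  = just (ren ρ t) ∷ renE ρ ϑ

wk : Λ k₁ → Λ (suc k₁)
wk = ren suc

lift : (Fin k₁ → Λ k₂) → Fin (suc k₁) → Λ (suc k₂)
lift σ zero    = # zero
lift σ (suc i) = wk (σ i)

mutual
  sub : (Fin k₁ → Λ k₂) → Λ k₁ → Λ k₂
  sub σ (# i)   = σ i
  sub σ ★       = ★
  sub σ (ƛ t)   = ƛ sub (lift σ) t
  sub σ (t · u) = sub σ t · sub σ u
  sub σ (τ ϑ)   = τ (subE σ ϑ)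

  subE : (Fin k₁ → Λ k₂) → Entries k₁ j → Entries k₂ j
  subE σ []            = []
  subE σ (nothing ∷ ϑ) = nothing ∷ subE σ ϑ
  subE σ (just t ∷ ϑ)  = just (sub σ t) ∷ subE σ ϑ

_[_]₀ : Λ (suc k₁) → Λ k₁ → Λ k₁
t [ u ]₀ = sub (u ∷ᵉ #_) t

just-∷-cong : ∀ {X : Set} {x y : X} {xs ys : Vec (Maybe X) j}
  → x ≡ y → xs ≡ ys → just x ∷ xs ≡ just y ∷ ys
just-∷-cong = cong₂ (λ x xs → just x ∷ xs)

mutual
  ren-cong : {ρ ρ' : Fin k₁ → Fin k₂} → (∀ i → ρ i ≡ ρ' i) → (t : Λ k₁)
    → ren ρ t ≡ ren ρ' t
  ren-cong e (# i)   = cong #_ (e i)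
  ren-cong e ★       = refl
  ren-cong e (ƛ t)   = cong ƛ_ (ren-cong (λ { zero → refl ; (suc i) → cong suc (e i) }) t)
  ren-cong e (t · u) = cong₂ _·_ (ren-cong e t) (ren-cong e u)
  ren-cong e (τ ϑ)   = cong τ (renE-cong e ϑ)

  renE-cong : {ρ ρ' : Fin k₁ → Fin k₂} → (∀ i → ρ i ≡ ρ' i) → (ϑ : Entries k₁ j)
    → renE ρ ϑ ≡ renE ρ' ϑ
  renE-cong e []            = refl
  renE-cong e (nothing ∷ ϑ) = cong (nothing ∷_) (renE-cong e ϑ)
  renE-cong e (just t ∷ ϑ)  = just-∷-cong (ren-cong e t) (renE-cong e ϑ)

mutual
  sub-cong : {σ σ' : Fin k₁ → Λ k₂} → (∀ i → σ i ≡ σ' i) → (t : Λ k₁)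
    → sub σ t ≡ sub σ' t
  sub-cong e (# i)   = e i
  sub-cong e ★       = refl
  sub-cong e (ƛ t)   = cong ƛ_ (sub-cong (λ { zero → refl ; (suc i) → cong wk (e i) }) t)
  sub-cong e (t · u) = cong₂ _·_ (sub-cong e t) (sub-cong e u)
  sub-cong e (τ ϑ)   = cong τ (subE-cong e ϑ)

  subE-cong : {σ σ' : Fin k₁ → Λ k₂} → (∀ i → σ i ≡ σ' i) → (ϑ : Entries k₁ j)
    → subE σ ϑ ≡ subE σ' ϑ
  subE-cong e []            = refl
  subE-cong e (nothing ∷ ϑ) = cong (nothing ∷_) (subE-cong e ϑ)
  subE-cong e (just t ∷ ϑ)  = just-∷-cong (sub-cong e t) (subE-cong e ϑ)

mutual
  ren-ren : (ρ : Fin k₂ → Fin k₃) (ρ' : Fin k₁ → Fin k₂) (t : Λ k₁)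
    → ren ρ (ren ρ' t) ≡ ren (ρ ∘ ρ') t
  ren-ren ρ ρ' (# i)   = refl
  ren-ren ρ ρ' ★       = refl
  ren-ren ρ ρ' (ƛ t)   = cong ƛ_ (trans (ren-ren (ext ρ) (ext ρ') t)
                                        (ren-cong (λ { zero → refl ; (suc i) → refl }) t))
  ren-ren ρ ρ' (t · u) = cong₂ _·_ (ren-ren ρ ρ' t) (ren-ren ρ ρ' u)
  ren-ren ρ ρ' (τ ϑ)   = cong τ (renE-ren ρ ρ' ϑ)

  renE-ren : (ρ : Fin k₂ → Fin k₃) (ρ' : Fin k₁ → Fin k₂) (ϑ : Entries k₁ j)
    → renE ρ (renE ρ' ϑ) ≡ renE (ρ ∘ ρ') ϑ
  renE-ren ρ ρ' []            = refl
  renE-ren ρ ρ' (nothing ∷ ϑ) = cong (nothing ∷_) (renE-ren ρ ρ' ϑ)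
  renE-ren ρ ρ' (just t ∷ ϑ)  = just-∷-cong (ren-ren ρ ρ' t) (renE-ren ρ ρ' ϑ)

mutual
  sub-ren : (σ : Fin k₂ → Λ k₃) (ρ : Fin k₁ → Fin k₂) (t : Λ k₁)
    → sub σ (ren ρ t) ≡ sub (σ ∘ ρ) t
  sub-ren σ ρ (# i)   = refl
  sub-ren σ ρ ★       = refl
  sub-ren σ ρ (ƛ t)   = cong ƛ_ (trans (sub-ren (lift σ) (ext ρ) t)
                                       (sub-cong (λ { zero → refl ; (suc i) → refl }) t))
  sub-ren σ ρ (t · u) = cong₂ _·_ (sub-ren σ ρ t) (sub-ren σ ρ u)
  sub-ren σ ρ (τ ϑ)   = cong τ (subE-ren σ ρ ϑ)

  subE-ren : (σ : Fin k₂ → Λ k₃) (ρ : Fin k₁ → Fin k₂) (ϑ : Entries k₁ j)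
    → subE σ (renE ρ ϑ) ≡ subE (σ ∘ ρ) ϑ
  subE-ren σ ρ []            = refl
  subE-ren σ ρ (nothing ∷ ϑ) = cong (nothing ∷_) (subE-ren σ ρ ϑ)
  subE-ren σ ρ (just t ∷ ϑ)  = just-∷-cong (sub-ren σ ρ t) (subE-ren σ ρ ϑ)

ext-wk : (ρ : Fin k₁ → Fin k₂) (t : Λ k₁) → ren (ext ρ) (wk t) ≡ wk (ren ρ t)
ext-wk ρ t = trans (ren-ren (ext ρ) suc t) (sym (ren-ren suc ρ t))

mutual
  ren-sub : (ρ : Fin k₂ → Fin k₃) (σ : Fin k₁ → Λ k₂) (t : Λ k₁)
    → ren ρ (sub σ t) ≡ sub (ren ρ ∘ σ) t
  ren-sub ρ σ (# i)   = refl
  ren-sub ρ σ ★       = refl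
  ren-sub ρ σ (ƛ t)   = cong ƛ_ (trans (ren-sub (ext ρ) (lift σ) t)
                                       (sub-cong (λ { zero → refl ; (suc i) → ext-wk ρ (σ i) }) t))
  ren-sub ρ σ (t · u) = cong₂ _·_ (ren-sub ρ σ t) (ren-sub ρ σ u)
  ren-sub ρ σ (τ ϑ)   = cong τ (renE-sub ρ σ ϑ)

  renE-sub : (ρ : Fin k₂ → Fin k₃) (σ : Fin k₁ → Λ k₂) (ϑ : Entries k₁ j)
    → renE ρ (subE σ ϑ) ≡ subE (ren ρ ∘ σ) ϑ
  renE-sub ρ σ []            = refl
  renE-sub ρ σ (nothing ∷ ϑ) = cong (nothing ∷_) (renE-sub ρ σ ϑ)
  renE-sub ρ σ (just t ∷ ϑ)  = just-∷-cong (ren-sub ρ σ t) (renE-sub ρ σ ϑ)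

lift-wk : (σ : Fin k₁ → Λ k₂) (t : Λ k₁) → sub (lift σ) (wk t) ≡ wk (sub σ t)
lift-wk σ t = trans (sub-ren (lift σ) suc t) (sym (ren-sub suc σ t))

mutual
  sub-sub : (σ' : Fin k₂ → Λ k₃) (σ : Fin k₁ → Λ k₂) (t : Λ k₁)
    → sub σ' (sub σ t) ≡ sub (sub σ' ∘ σ) t
  sub-sub σ' σ (# i)   = refl
  sub-sub σ' σ ★       = refl
  sub-sub σ' σ (ƛ t)   = cong ƛ_ (trans (sub-sub (lift σ') (lift σ) t)
                                        (sub-cong (λ { zero → refl ; (suc i) → lift-wk σ' (σ i) }) t))
  sub-sub σ' σ (t · u) = cong₂ _·_ (sub-sub σ' σ t) (sub-sub σ' σ u)
  sub-sub σ' σ (τ ϑ)   = cong τ (subE-sub σ' σ ϑ)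

  subE-sub : (σ' : Fin k₂ → Λ k₃) (σ : Fin k₁ → Λ k₂) (ϑ : Entries k₁ j)
    → subE σ' (subE σ ϑ) ≡ subE (sub σ' ∘ σ) ϑ
  subE-sub σ' σ []            = refl
  subE-sub σ' σ (nothing ∷ ϑ) = cong (nothing ∷_) (subE-sub σ' σ ϑ)
  subE-sub σ' σ (just t ∷ ϑ)  = just-∷-cong (sub-sub σ' σ t) (subE-sub σ' σ ϑ)

mutual
  sub-id : (t : Λ k₁) → sub #_ t ≡ t
  sub-id (# i)   = refl
  sub-id ★       = refl
  sub-id (ƛ t)   = cong ƛ_ (trans (sub-cong (λ { zero → refl ; (suc i) → refl }) t) (sub-id t))
  sub-id (t · u) = cong₂ _·_ (sub-id t) (sub-id u)
  sub-id (τ ϑ)   = cong τ (subE-id ϑ)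

  subE-id : (ϑ : Entries k₁ j) → subE #_ ϑ ≡ ϑ
  subE-id []            = refl
  subE-id (nothing ∷ ϑ) = cong (nothing ∷_) (subE-id ϑ)
  subE-id (just t ∷ ϑ)  = just-∷-cong (sub-id t) (subE-id ϑ)

wk-[]₀ : (t u : Λ k₁) → wk t [ u ]₀ ≡ t
wk-[]₀ t u = trans (sub-ren (u ∷ᵉ #_) suc t) (sub-id t)

sub-[]₀ : (σ : Fin k₁ → Λ k₂) (t : Λ (suc k₁)) (u : Λ k₁)
  → sub (lift σ) t [ sub σ u ]₀ ≡ sub σ (t [ u ]₀)
sub-[]₀ σ t u =
  trans (sub-sub _ (lift σ) t)
    (trans (sub-cong (λ { zero → refl ; (suc i) → wk-[]₀ (σ i) (sub σ u) }) t)
           (sym (sub-sub σ _ t)))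

data Nullary : Label → Set where
  refl-nullary   : Nullary ℓrefl
  β-nullary      : Nullary ℓβ
  β□-nullary     : Nullary ℓβ□
  ti-nullary     : Nullary ℓti
  trpl[]-nullary : Nullary ℓtrpl[]
  d-nullary      : Nullary ℓd

data Binary : Label → Set where
  trans-binary : Binary ℓtrans
  app-binary   : Binary ℓapp
  let-binary   : Binary ℓlet
  trpl∷-binary : Binary ℓtrpl∷

-- The shapes of the results q ϑ of instantiating a trail q with ϑ: a tree
-- whose leaves are entries of nullary labels, whose unary nodes apply the
-- lam entry and whose binary nodes apply the entry of a binary label.
data Combination (ϑ : Map (Λ k₁)) : Λ k₁ → Set where
  leaf  : ∀ {ψ c} → Nullary ψ → ϑ !! ψ ≡ just c → Combination ϑ c
  node1 : ∀ {c t} → ϑ !! ℓlam ≡ just c → Combination ϑ t → Combination ϑ (c · t)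
  node2 : ∀ {ψ c t u} → Binary ψ → ϑ !! ψ ≡ just c
        → Combination ϑ t → Combination ϑ u → Combination ϑ (c · t · u)

infix 4 _⇝_ _⇝E_

mutual
  data _⇝_ {k} : Λ k → Λ k → Set where
    β       : ∀ {t u} → (ƛ t) · u ⇝ t [ u ]₀
    τ-ti    : ∀ {ϑ t} → Combination ϑ t → τ ϑ ⇝ t
    ƛ-cong  : ∀ {t t'} → t ⇝ t' → ƛ t ⇝ ƛ t'
    ·-congˡ : ∀ {t t' u} → t ⇝ t' → t · u ⇝ t' · u
    ·-congʳ : ∀ {t u u'} → u ⇝ u' → t · u ⇝ t · u'
    τ-cong  : ∀ {ϑ ϑ'} → ϑ ⇝E ϑ' → τ ϑ ⇝ τ ϑ'

  data _⇝E_ {k} : ∀ {j} → Entries k j → Entries k j → Set where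
    here  : ∀ {j t t'} {ϑ : Entries k j} → t ⇝ t' → just t ∷ ϑ ⇝E just t' ∷ ϑ
    there : ∀ {j x} {ϑ ϑ' : Entries k j} → ϑ ⇝E ϑ' → x ∷ ϑ ⇝E x ∷ ϑ'

lookup-subE : (σ : Fin k₁ → Λ k₂) (ϑ : Entries k₁ j) (i : Fin j) {c : Λ k₁}
  → lookup ϑ i ≡ just c → lookup (subE σ ϑ) i ≡ just (sub σ c)
lookup-subE σ (just x ∷ ϑ)  zero    refl = refl
lookup-subE σ (just x ∷ ϑ)  (suc i) e    = lookup-subE σ ϑ i e
lookup-subE σ (nothing ∷ ϑ) (suc i) e    = lookup-subE σ ϑ i e

Combination-sub : (σ : Fin k₁ → Λ k₂) {ϑ : Map (Λ k₁)} {t : Λ k₁}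
  → Combination ϑ t → Combination (subE σ ϑ) (sub σ t)
Combination-sub σ {ϑ} (leaf {ψ} n e) = leaf n (lookup-subE σ ϑ (ix ψ) e)
Combination-sub σ {ϑ} (node1 e c) = node1 (lookup-subE σ ϑ (ix ℓlam) e) (Combination-sub σ c)
Combination-sub σ {ϑ} (node2 {ψ} b e c d) =
  node2 b (lookup-subE σ ϑ (ix ψ) e) (Combination-sub σ c) (Combination-sub σ d)

mutual
  ⇝-sub : (σ : Fin k₁ → Λ k₂) {t t' : Λ k₁} → t ⇝ t' → sub σ t ⇝ sub σ t'
  ⇝-sub σ (β {t} {u})  = subst (sub σ ((ƛ t) · u) ⇝_) (sub-[]₀ σ t u) β
  ⇝-sub σ (τ-ti c)     = τ-ti (Combination-sub σ c)
  ⇝-sub σ (ƛ-cong s)   = ƛ-cong (⇝-sub (lift σ) s)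
  ⇝-sub σ (·-congˡ s)  = ·-congˡ (⇝-sub σ s)
  ⇝-sub σ (·-congʳ s)  = ·-congʳ (⇝-sub σ s)
  ⇝-sub σ (τ-cong s)   = τ-cong (⇝E-sub σ s)

  ⇝E-sub : (σ : Fin k₁ → Λ k₂) {ϑ ϑ' : Entries k₁ j} → ϑ ⇝E ϑ' → subE σ ϑ ⇝E subE σ ϑ'
  ⇝E-sub σ (here s)                = here (⇝-sub σ s)
  ⇝E-sub σ (there {x = nothing} s) = there (⇝E-sub σ s)
  ⇝E-sub σ (there {x = just _} s)  = there (⇝E-sub σ s)

⇝E-lookup : {ϑ ϑ' : Entries k₁ j} → ϑ ⇝E ϑ' → ∀ i {c'} → lookup ϑ' i ≡ just c'
  → ∃ λ c → lookup ϑ i ≡ just c × (c ≡ c' ⊎ c ⇝ c')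
⇝E-lookup (here {t = t} s) zero    refl = t , refl , inj₂ s
⇝E-lookup (here s)         (suc i) e    = _ , e , inj₁ refl
⇝E-lookup (there s)        zero    e    = _ , e , inj₁ refl
⇝E-lookup (there s)        (suc i) e    = ⇝E-lookup s i e

SN : Λ k₁ → Set
SN = Acc (flip _⇝_)

SNE : Entries k₁ j → Set
SNE = Acc (flip _⇝E_)

SN-·ˡ : {t u : Λ k₁} → SN (t · u) → SN t
SN-·ˡ (acc g) = acc (λ s → SN-·ˡ (g (·-congˡ s)))

SN-sub⁻¹ : (σ : Fin k₁ → Λ k₂) {t : Λ k₁} → SN (sub σ t) → SN t
SN-sub⁻¹ σ (acc g) = acc (λ s → SN-sub⁻¹ σ (g (⇝-sub σ s)))

SNE-nothing∷ : {ϑ : Entries k₁ j} → SNE ϑ → SNE (nothing ∷ ϑ)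
SNE-nothing∷ (acc g) = acc λ { (there s) → SNE-nothing∷ (g s) }

SNE-just∷ : {t : Λ k₁} {ϑ : Entries k₁ j} → SN t → SNE ϑ → SNE (just t ∷ ϑ)
SNE-just∷ (acc f) (acc g) =
  acc λ { (here s) → SNE-just∷ (f s) (acc g) ; (there s) → SNE-just∷ (acc f) (g s) }

SNE-all : (ϑ : Entries k₁ j) → (∀ i c → lookup ϑ i ≡ just c → SN c) → SNE ϑ
SNE-all []            h = acc λ ()
SNE-all (nothing ∷ ϑ) h = SNE-nothing∷ (SNE-all ϑ (λ i → h (suc i)))
SNE-all (just t ∷ ϑ)  h = SNE-just∷ (h zero t refl) (SNE-all ϑ (λ i → h (suc i)))

Acc⇒¬InfiniteDescent : ∀ {A : Set} {_<_ : A → A → Set} {x} (f : ℕ → A)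
  → Acc _<_ x → ¬ InfiniteDescendingSequenceFrom _<_ f x
Acc⇒¬InfiniteDescent f (acc rs) (refl , desc) =
  Acc⇒¬InfiniteDescent (f ∘ suc) (rs (desc 0)) (refl , desc ∘ suc)

infixr 7 _⇒_

data Ty : Set where
  ι   : Ty
  _⇒_ : Ty → Ty → Ty

arity : Ty → Label → Ty
arity B ℓlam   = B ⇒ B
arity B ℓtrans = B ⇒ B ⇒ B
arity B ℓapp   = B ⇒ B ⇒ B
arity B ℓlet   = B ⇒ B ⇒ B
arity B ℓtrpl∷ = B ⇒ B ⇒ B
arity B _      = B

Red : Ty → Λ k₁ → Set
Red ι       t = SN t
Red (A ⇒ B) t = ∀ u → Red A u → Red B (t · u)

data Neutral {k} : Λ k → Set where
  #-neutral : ∀ {i} → Neutral (# i)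
  ★-neutral : Neutral ★
  ·-neutral : ∀ {t u} → Neutral (t · u)
  τ-neutral : ∀ {ϑ} → Neutral (τ ϑ)

mutual
  Red⇒SN : ∀ A {t : Λ k₁} → Red A t → SN t
  Red⇒SN ι       r = r
  Red⇒SN (A ⇒ B) r = SN-·ˡ (Red⇒SN B (r ★ (★-Red A)))

  ★-Red : ∀ A → Red {k₁} A ★
  ★-Red A = neutral-Red A ★-neutral (λ ())

  Red-⇝ : ∀ A {t t' : Λ k₁} → Red A t → t ⇝ t' → Red A t'
  Red-⇝ ι       (acc g) s      = g s
  Red-⇝ (A ⇒ B) r       s u ru = Red-⇝ B (r u ru) (·-congˡ s)

  neutral-Red : ∀ A {t : Λ k₁} → Neutral t → (∀ {t'} → t ⇝ t' → Red A t') → Red A t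
  neutral-Red ι       _  h      = acc h
  neutral-Red (A ⇒ B) ne h u ru = neutral-Red-· ne h (Red⇒SN A ru) ru
    where
    mutual
      neutral-Red-· : ∀ {t u} → Neutral t → (∀ {t'} → t ⇝ t' → Red (A ⇒ B) t')
                    → SN u → Red A u → Red B (t · u)
      neutral-Red-· ne h snu ru = neutral-Red B ·-neutral (reduct-Red ne h snu ru)

      reduct-Red : ∀ {t u t'} → Neutral t → (∀ {t'} → t ⇝ t' → Red (A ⇒ B) t')
                 → SN u → Red A u → t · u ⇝ t' → Red B t'
      reduct-Red ()  h _       ru β
      reduct-Red ne h _       ru (·-congˡ s) = h s _ ru
      reduct-Red ne h (acc g) ru (·-congʳ s) = neutral-Red-· ne h (g s) (Red-⇝ A ru s)

Red-β : ∀ A B {t : Λ (suc k₁)} {u : Λ k₁}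
  → (∀ v → Red A v → Red B (t [ v ]₀)) → Red A u → Red B ((ƛ t) · u)
Red-β A B h ru = go (SN-sub⁻¹ _ (Red⇒SN B (h ★ (★-Red A)))) (Red⇒SN A ru) h ru
  where
  go : ∀ {t u} → SN t → SN u → (∀ v → Red A v → Red B (t [ v ]₀)) → Red A u
     → Red B ((ƛ t) · u)
  go {u = u} (acc gt) (acc gu) h ru = neutral-Red B ·-neutral λ where
    β                    → h u ru
    (·-congˡ (ƛ-cong s)) → go (gt s) (acc gu) (λ v rv → Red-⇝ B (h v rv) (⇝-sub _ s)) ru
    (·-congʳ s)          → go (acc gt) (gu s) h (Red-⇝ A ru s)

ix-surjective : ∀ i → ∃ λ ψ → ix ψ ≡ i
ix-surjective zero = ℓrefl , refl
ix-surjective (suc zero) = ℓtrans , refl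
ix-surjective (suc (suc zero)) = ℓβ , refl
ix-surjective (suc (suc (suc zero))) = ℓβ□ , refl
ix-surjective (suc (suc (suc (suc zero)))) = ℓti , refl
ix-surjective (suc (suc (suc (suc (suc zero))))) = ℓlam , refl
ix-surjective (suc (suc (suc (suc (suc (suc zero)))))) = ℓapp , refl
ix-surjective (suc (suc (suc (suc (suc (suc (suc zero))))))) = ℓlet , refl
ix-surjective (suc (suc (suc (suc (suc (suc (suc (suc zero)))))))) = ℓtrpl[] , refl
ix-surjective (suc (suc (suc (suc (suc (suc (suc (suc (suc zero))))))))) = ℓtrpl∷ , refl
ix-surjective (suc (suc (suc (suc (suc (suc (suc (suc (suc (suc zero)))))))))) = ℓd , refl

EntriesRed : Ty → Map (Λ k₁) → Set
EntriesRed B ϑ = ∀ ψ c → ϑ !! ψ ≡ just c → Red (arity B ψ) c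

EntriesRed⇒SNE : ∀ B {ϑ : Map (Λ k₁)} → EntriesRed B ϑ → SNE ϑ
EntriesRed⇒SNE B {ϑ} r = SNE-all ϑ entry-SN
  where
  entry-SN : ∀ i c → lookup ϑ i ≡ just c → SN c
  entry-SN i c e with ix-surjective i
  ... | ψ , refl = Red⇒SN (arity B ψ) (r ψ c e)

EntriesRed-⇝ : ∀ B {ϑ ϑ' : Map (Λ k₁)} → ϑ ⇝E ϑ' → EntriesRed B ϑ → EntriesRed B ϑ'
EntriesRed-⇝ B s r ψ c' e with ⇝E-lookup s (ix ψ) e
... | c , e' , inj₁ refl = r ψ c e'
... | c , e' , inj₂ st   = Red-⇝ (arity B ψ) (r ψ c e') st

arity-nullary : ∀ B {ψ} → Nullary ψ → arity B ψ ≡ B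
arity-nullary B refl-nullary   = refl
arity-nullary B β-nullary      = refl
arity-nullary B β□-nullary     = refl
arity-nullary B ti-nullary     = refl
arity-nullary B trpl[]-nullary = refl
arity-nullary B d-nullary      = refl

arity-binary : ∀ B {ψ} → Binary ψ → arity B ψ ≡ B ⇒ B ⇒ B
arity-binary B trans-binary = refl
arity-binary B app-binary   = refl
arity-binary B let-binary   = refl
arity-binary B trpl∷-binary = refl

Combination-Red : ∀ B {ϑ : Map (Λ k₁)} {t} → EntriesRed B ϑ → Combination ϑ t → Red B t
Combination-Red B r (leaf {ψ} n e) = subst (λ X → Red X _) (arity-nullary B n) (r ψ _ e)
Combination-Red B r (node1 e c)    = r ℓlam _ e _ (Combination-Red B r c)
Combination-Red B r (node2 {ψ} b e c d) =
  subst (λ X → Red X _) (arity-binary B b) (r ψ _ e)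
    _ (Combination-Red B r c) _ (Combination-Red B r d)

Red-τ : ∀ B {ϑ : Map (Λ k₁)} → EntriesRed B ϑ → Red B (τ ϑ)
Red-τ B r = go (EntriesRed⇒SNE B r) r
  where
  go : ∀ {ϑ} → SNE ϑ → EntriesRed B ϑ → Red B (τ ϑ)
  go (acc g) r = neutral-Red B τ-neutral λ where
    (τ-ti c)   → Combination-Red B r c
    (τ-cong s) → go (g s) (EntriesRed-⇝ B s r)

mutual
  erase : ∀ {n m} → (Fin n → Λ k₁) → (Fin m → Λ k₁) → Term n m → Λ k₁
  erase σs σa (var i)      = σs i
  erase σs σa (uvar i)     = σa i
  erase σs σa (lam A M)    = ƛ erase (lift σs) (wk ∘ σa) M
  erase σs σa (app M N)    = erase σs σa M · erase σs σa N
  erase σs σa (box q M)    = erase []ᵉ σa M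
  erase σs σa (mlet A M N) = (ƛ erase (wk ∘ σs) (lift σa) N) · erase σs σa M
  erase σs σa (TI ϑ)       = τ (eraseE σa ϑ)

  eraseE : ∀ {m} → (Fin m → Λ k₁) → Vec (Maybe (Term 0 m)) j → Entries k₁ j
  eraseE σa []            = []
  eraseE σa (nothing ∷ ϑ) = nothing ∷ eraseE σa ϑ
  eraseE σa (just M ∷ ϑ)  = just (erase []ᵉ σa M) ∷ eraseE σa ϑ

mutual
  erase-cong : ∀ {n m} {σs σs' : Fin n → Λ k₁} {σa σa' : Fin m → Λ k₁}
    → (∀ i → σs i ≡ σs' i) → (∀ i → σa i ≡ σa' i) → (M : Term n m)
    → erase σs σa M ≡ erase σs' σa' M
  erase-cong es ea (var i)      = es i
  erase-cong es ea (uvar i)     = ea i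
  erase-cong es ea (lam A M)    =
    cong ƛ_ (erase-cong (λ { zero → refl ; (suc i) → cong wk (es i) }) (cong wk ∘ ea) M)
  erase-cong es ea (app M N)    = cong₂ _·_ (erase-cong es ea M) (erase-cong es ea N)
  erase-cong es ea (box q M)    = erase-cong (λ ()) ea M
  erase-cong es ea (mlet A M N) =
    cong₂ (λ t u → (ƛ t) · u)
      (erase-cong (cong wk ∘ es) (λ { zero → refl ; (suc i) → cong wk (ea i) }) N)
      (erase-cong es ea M)
  erase-cong es ea (TI ϑ)       = cong τ (eraseE-cong ea ϑ)

  eraseE-cong : ∀ {m} {σa σa' : Fin m → Λ k₁} → (∀ i → σa i ≡ σa' i)
    → (ϑ : Vec (Maybe (Term 0 m)) j) → eraseE σa ϑ ≡ eraseE σa' ϑ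
  eraseE-cong ea []            = refl
  eraseE-cong ea (nothing ∷ ϑ) = cong (nothing ∷_) (eraseE-cong ea ϑ)
  eraseE-cong ea (just M ∷ ϑ)  = just-∷-cong (erase-cong (λ ()) ea M) (eraseE-cong ea ϑ)

erase-closed : ∀ {m} (σs : Fin 0 → Λ k₁) (σa : Fin m → Λ k₁) (M : Term 0 m)
  → erase σs σa M ≡ erase []ᵉ σa M
erase-closed σs σa = erase-cong (λ ()) (λ _ → refl)

mutual
  erase-renTm : ∀ {n m n' m'} (σs : Fin n' → Λ k₁) (σa : Fin m' → Λ k₁)
    (ρs : Fin n → Fin n') (ρa : Fin m → Fin m') (M : Term n m)
    → erase σs σa (renTm ρs ρa M) ≡ erase (σs ∘ ρs) (σa ∘ ρa) M
  erase-renTm σs σa ρs ρa (var i)      = refl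
  erase-renTm σs σa ρs ρa (uvar i)     = refl
  erase-renTm σs σa ρs ρa (lam A M)    =
    cong ƛ_ (trans (erase-renTm (lift σs) (wk ∘ σa) (ext ρs) ρa M)
                   (erase-cong (λ { zero → refl ; (suc i) → refl }) (λ _ → refl) M))
  erase-renTm σs σa ρs ρa (app M N)    =
    cong₂ _·_ (erase-renTm σs σa ρs ρa M) (erase-renTm σs σa ρs ρa N)
  erase-renTm σs σa ρs ρa (box q M)    = erase-renTm-closed σa ρa M
  erase-renTm σs σa ρs ρa (mlet A M N) =
    cong₂ (λ t u → (ƛ t) · u)
      (trans (erase-renTm (wk ∘ σs) (lift σa) ρs (ext ρa) N)
             (erase-cong (λ _ → refl) (λ { zero → refl ; (suc i) → refl }) N))
      (erase-renTm σs σa ρs ρa M)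
  erase-renTm σs σa ρs ρa (TI ϑ)       = cong τ (eraseE-renTmM σa ρa ϑ)

  eraseE-renTmM : ∀ {m m'} (σa : Fin m' → Λ k₁) (ρa : Fin m → Fin m') (ϑ : Vec (Maybe (Term 0 m)) j)
    → eraseE σa (renTmM ρa ϑ) ≡ eraseE (σa ∘ ρa) ϑ
  eraseE-renTmM σa ρa []            = refl
  eraseE-renTmM σa ρa (nothing ∷ ϑ) = cong (nothing ∷_) (eraseE-renTmM σa ρa ϑ)
  eraseE-renTmM σa ρa (just M ∷ ϑ)  = just-∷-cong (erase-renTm-closed σa ρa M) (eraseE-renTmM σa ρa ϑ)

  erase-renTm-closed : ∀ {m m'} (σa : Fin m' → Λ k₁) (ρa : Fin m → Fin m') (M : Term 0 m)
    → erase []ᵉ σa (renTm id ρa M) ≡ erase []ᵉ (σa ∘ ρa) M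
  erase-renTm-closed σa ρa M = trans (erase-renTm []ᵉ σa id ρa M) (erase-closed _ _ M)

mutual
  ren-erase : ∀ {n m} (ρ : Fin k₁ → Fin k₂) (σs : Fin n → Λ k₁) (σa : Fin m → Λ k₁) (M : Term n m)
    → ren ρ (erase σs σa M) ≡ erase (ren ρ ∘ σs) (ren ρ ∘ σa) M
  ren-erase ρ σs σa (var i)      = refl
  ren-erase ρ σs σa (uvar i)     = refl
  ren-erase ρ σs σa (lam A M)    =
    cong ƛ_ (trans (ren-erase (ext ρ) (lift σs) (wk ∘ σa) M)
                   (erase-cong (λ { zero → refl ; (suc i) → ext-wk ρ (σs i) }) (ext-wk ρ ∘ σa) M))
  ren-erase ρ σs σa (app M N)    = cong₂ _·_ (ren-erase ρ σs σa M) (ren-erase ρ σs σa N)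
  ren-erase ρ σs σa (box q M)    = ren-erase-closed ρ σa M
  ren-erase ρ σs σa (mlet A M N) =
    cong₂ (λ t u → (ƛ t) · u)
      (trans (ren-erase (ext ρ) (wk ∘ σs) (lift σa) N)
             (erase-cong (ext-wk ρ ∘ σs) (λ { zero → refl ; (suc i) → ext-wk ρ (σa i) }) N))
      (ren-erase ρ σs σa M)
  ren-erase ρ σs σa (TI ϑ)       = cong τ (renE-eraseE ρ σa ϑ)

  renE-eraseE : ∀ {m} (ρ : Fin k₁ → Fin k₂) (σa : Fin m → Λ k₁) (ϑ : Vec (Maybe (Term 0 m)) j)
    → renE ρ (eraseE σa ϑ) ≡ eraseE (ren ρ ∘ σa) ϑ
  renE-eraseE ρ σa []            = refl
  renE-eraseE ρ σa (nothing ∷ ϑ) = cong (nothing ∷_) (renE-eraseE ρ σa ϑ)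
  renE-eraseE ρ σa (just M ∷ ϑ)  = just-∷-cong (ren-erase-closed ρ σa M) (renE-eraseE ρ σa ϑ)

  ren-erase-closed : ∀ {m} (ρ : Fin k₁ → Fin k₂) (σa : Fin m → Λ k₁) (M : Term 0 m)
    → ren ρ (erase []ᵉ σa M) ≡ erase []ᵉ (ren ρ ∘ σa) M
  ren-erase-closed ρ σa M = trans (ren-erase ρ []ᵉ σa M) (erase-closed _ _ M)

mutual
  sub-erase : ∀ {n m} (σ : Fin k₁ → Λ k₂) (σs : Fin n → Λ k₁) (σa : Fin m → Λ k₁) (M : Term n m)
    → sub σ (erase σs σa M) ≡ erase (sub σ ∘ σs) (sub σ ∘ σa) M
  sub-erase σ σs σa (var i)      = refl
  sub-erase σ σs σa (uvar i)     = refl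
  sub-erase σ σs σa (lam A M)    =
    cong ƛ_ (trans (sub-erase (lift σ) (lift σs) (wk ∘ σa) M)
                   (erase-cong (λ { zero → refl ; (suc i) → lift-wk σ (σs i) }) (lift-wk σ ∘ σa) M))
  sub-erase σ σs σa (app M N)    = cong₂ _·_ (sub-erase σ σs σa M) (sub-erase σ σs σa N)
  sub-erase σ σs σa (box q M)    = sub-erase-closed σ σa M
  sub-erase σ σs σa (mlet A M N) =
    cong₂ (λ t u → (ƛ t) · u)
      (trans (sub-erase (lift σ) (wk ∘ σs) (lift σa) N)
             (erase-cong (lift-wk σ ∘ σs) (λ { zero → refl ; (suc i) → lift-wk σ (σa i) }) N))
      (sub-erase σ σs σa M)
  sub-erase σ σs σa (TI ϑ)       = cong τ (subE-eraseE σ σa ϑ)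

  subE-eraseE : ∀ {m} (σ : Fin k₁ → Λ k₂) (σa : Fin m → Λ k₁) (ϑ : Vec (Maybe (Term 0 m)) j)
    → subE σ (eraseE σa ϑ) ≡ eraseE (sub σ ∘ σa) ϑ
  subE-eraseE σ σa []            = refl
  subE-eraseE σ σa (nothing ∷ ϑ) = cong (nothing ∷_) (subE-eraseE σ σa ϑ)
  subE-eraseE σ σa (just M ∷ ϑ)  = just-∷-cong (sub-erase-closed σ σa M) (subE-eraseE σ σa ϑ)

  sub-erase-closed : ∀ {m} (σ : Fin k₁ → Λ k₂) (σa : Fin m → Λ k₁) (M : Term 0 m)
    → sub σ (erase []ᵉ σa M) ≡ erase []ᵉ (sub σ ∘ σa) M
  sub-erase-closed σ σa M = trans (sub-erase σ []ᵉ σa M) (erase-closed _ _ M)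

erase-subTm : ∀ {n n' m} (σs : Fin n' → Λ k₁) (σa : Fin m → Λ k₁)
  (ρ : Fin n → Term n' m) (M : Term n m)
  → erase σs σa (subTm ρ M) ≡ erase (erase σs σa ∘ ρ) σa M
erase-subTm σs σa ρ (var i)      = refl
erase-subTm σs σa ρ (uvar i)     = refl
erase-subTm σs σa ρ (lam A M)    =
  cong ƛ_ (trans (erase-subTm (lift σs) (wk ∘ σa) (liftSTm ρ) M)
                 (erase-cong (λ { zero → refl ; (suc i) → wk-erase (ρ i) }) (λ _ → refl) M))
  where
  wk-erase : ∀ L → erase (lift σs) (wk ∘ σa) (renTm suc id L) ≡ wk (erase σs σa L)
  wk-erase L = trans (erase-renTm (lift σs) (wk ∘ σa) suc id L) (sym (ren-erase suc σs σa L))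
erase-subTm σs σa ρ (app M N)    = cong₂ _·_ (erase-subTm σs σa ρ M) (erase-subTm σs σa ρ N)
erase-subTm σs σa ρ (box q M)    = refl
erase-subTm σs σa ρ (mlet A M N) =
  cong₂ (λ t u → (ƛ t) · u)
    (trans (erase-subTm (wk ∘ σs) (lift σa) (renTm id suc ∘ ρ) N)
           (erase-cong (λ i → wk-erase (ρ i)) (λ _ → refl) N))
    (erase-subTm σs σa ρ M)
  where
  wk-erase : ∀ L → erase (wk ∘ σs) (lift σa) (renTm id suc L) ≡ wk (erase σs σa L)
  wk-erase L = trans (erase-renTm (wk ∘ σs) (lift σa) id suc L) (sym (ren-erase suc σs σa L))
erase-subTm σs σa ρ (TI ϑ)       = refl

eraseASub : ∀ {m'} → (Fin m' → Λ k₁) → Fin m' ⊎ (Term 0 m' × Trail 0 m' × Code 0 m') → Λ k₁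
eraseASub σa (inj₁ j)           = σa j
eraseASub σa (inj₂ (N , _ , _)) = erase []ᵉ σa N

eraseASub-wk : ∀ {m'} (σa : Fin m' → Λ k₁) x → eraseASub (wk ∘ σa) x ≡ wk (eraseASub σa x)
eraseASub-wk σa (inj₁ j)           = refl
eraseASub-wk σa (inj₂ (N , _ , _)) = sym (ren-erase-closed suc σa N)

eraseASub-lift : ∀ {m m'} (σa : Fin m' → Λ k₁) (δ : ASub m m') (i : Fin (suc m))
  → eraseASub (lift σa) (liftASub δ i) ≡ lift (eraseASub σa ∘ δ) i
eraseASub-lift σa δ zero = refl
eraseASub-lift σa δ (suc i) with δ i
... | inj₁ j           = refl
... | inj₂ (N , _ , _) =
  trans (erase-renTm-closed (lift σa) suc N) (sym (ren-erase-closed suc σa N))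

erase-uvar⋉ : ∀ {n m'} (σs : Fin n → Λ k₁) (σa : Fin m' → Λ k₁) x
  → erase σs σa (uvar⋉ x) ≡ eraseASub σa x
erase-uvar⋉ σs σa (inj₁ j)           = refl
erase-uvar⋉ σs σa (inj₂ (N , _ , _)) = trans (erase-renTm σs σa (λ ()) id N) (erase-closed _ _ N)

mutual
  erase-⋉ : ∀ {n m m'} (σs : Fin n → Λ k₁) (σa : Fin m' → Λ k₁) (δ : ASub m m') (M : Term n m)
    → erase σs σa (M ⋉ δ) ≡ erase σs (eraseASub σa ∘ δ) M
  erase-⋉ σs σa δ (var i)      = refl
  erase-⋉ σs σa δ (uvar i)     = erase-uvar⋉ σs σa (δ i)
  erase-⋉ σs σa δ (lam A M)    =
    cong ƛ_ (trans (erase-⋉ (lift σs) (wk ∘ σa) δ M)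
                   (erase-cong (λ _ → refl) (eraseASub-wk σa ∘ δ) M))
  erase-⋉ σs σa δ (app M N)    = cong₂ _·_ (erase-⋉ σs σa δ M) (erase-⋉ σs σa δ N)
  erase-⋉ σs σa δ (box q M)    = erase-⋉ []ᵉ σa δ M
  erase-⋉ σs σa δ (mlet A M N) =
    cong₂ (λ t u → (ƛ t) · u)
      (trans (erase-⋉ (wk ∘ σs) (lift σa) (liftASub δ) N)
             (erase-cong (λ _ → refl) (eraseASub-lift σa δ) N))
      (erase-⋉ σs σa δ M)
  erase-⋉ σs σa δ (TI ϑ)       = cong τ (eraseE-ltimesM σa δ ϑ)

  eraseE-ltimesM : ∀ {m m'} (σa : Fin m' → Λ k₁) (δ : ASub m m') (ϑ : Vec (Maybe (Term 0 m)) j)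
    → eraseE σa (ltimesM ϑ δ) ≡ eraseE (eraseASub σa ∘ δ) ϑ
  eraseE-ltimesM σa δ []            = refl
  eraseE-ltimesM σa δ (nothing ∷ ϑ) = cong (nothing ∷_) (eraseE-ltimesM σa δ ϑ)
  eraseE-ltimesM σa δ (just M ∷ ϑ)  = just-∷-cong (erase-⋉ []ᵉ σa δ M) (eraseE-ltimesM σa δ ϑ)

erase-lift-[]₀ : ∀ {n m} (σs : Fin n → Λ k₁) (σa : Fin m → Λ k₁) (M : Term (suc n) m) (v : Λ k₁)
  → erase (lift σs) (wk ∘ σa) M [ v ]₀ ≡ erase (v ∷ᵉ σs) σa M
erase-lift-[]₀ σs σa M v =
  trans (sub-erase _ (lift σs) (wk ∘ σa) M)
        (erase-cong (λ { zero → refl ; (suc i) → wk-[]₀ (σs i) v }) (λ i → wk-[]₀ (σa i) v) M)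

erase-liftᵃ-[]₀ : ∀ {n m} (σs : Fin n → Λ k₁) (σa : Fin m → Λ k₁) (N : Term n (suc m)) (v : Λ k₁)
  → erase (wk ∘ σs) (lift σa) N [ v ]₀ ≡ erase σs (v ∷ᵉ σa) N
erase-liftᵃ-[]₀ σs σa N v =
  trans (sub-erase _ (wk ∘ σs) (lift σa) N)
        (erase-cong (λ i → wk-[]₀ (σs i) v) (λ { zero → refl ; (suc i) → wk-[]₀ (σa i) v }) N)

erase-[/a] : ∀ {n m} (σs : Fin n → Λ k₁) (σa : Fin m → Λ k₁) (M : Term (suc n) m) (N : Term n m)
  → erase σs σa (M [ N /a]ᵐ) ≡ erase (lift σs) (wk ∘ σa) M [ erase σs σa N ]₀
erase-[/a] σs σa M N = begin
  erase σs σa (M [ N /a]ᵐ)                     ≡⟨ erase-subTm σs σa (sgTm N) M ⟩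
  erase (erase σs σa ∘ sgTm N) σa M
    ≡⟨ erase-cong (λ { zero → refl ; (suc i) → refl }) (λ _ → refl) M ⟩
  erase (erase σs σa N ∷ᵉ σs) σa M             ≡⟨ erase-lift-[]₀ σs σa M _ ⟨
  erase (lift σs) (wk ∘ σa) M [ erase σs σa N ]₀ ∎
  where open ≡-Reasoning

erase-⋉-sgδ : ∀ {n m} (σs : Fin n → Λ k₁) (σa : Fin m → Λ k₁) (N : Term n (suc m)) M q t
  → erase σs σa (N ⋉ sgδ M q t) ≡ erase (wk ∘ σs) (lift σa) N [ erase []ᵉ σa M ]₀
erase-⋉-sgδ σs σa N M q t = begin
  erase σs σa (N ⋉ sgδ M q t)                    ≡⟨ erase-⋉ σs σa (sgδ M q t) N ⟩
  erase σs (eraseASub σa ∘ sgδ M q t) N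
    ≡⟨ erase-cong (λ _ → refl) (λ { zero → refl ; (suc i) → refl }) N ⟩
  erase σs (erase []ᵉ σa M ∷ᵉ σa) N              ≡⟨ erase-liftᵃ-[]₀ σs σa N _ ⟨
  erase (wk ∘ σs) (lift σa) N [ erase []ᵉ σa M ]₀ ∎
  where open ≡-Reasoning

lookup-eraseE : ∀ {m} (σa : Fin m → Λ k₁) (ϑ : Vec (Maybe (Term 0 m)) j) (i : Fin j) {M}
  → lookup ϑ i ≡ just M → lookup (eraseE σa ϑ) i ≡ just (erase []ᵉ σa M)
lookup-eraseE σa (just M ∷ ϑ)  zero    refl = refl
lookup-eraseE σa (just _ ∷ ϑ)  (suc i) e    = lookup-eraseE σa ϑ i e
lookup-eraseE σa (nothing ∷ ϑ) (suc i) e    = lookup-eraseE σa ϑ i e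

lookup-eraseE⁻¹ : ∀ {m} (σa : Fin m → Λ k₁) (ϑ : Vec (Maybe (Term 0 m)) j) (i : Fin j) {c}
  → lookup (eraseE σa ϑ) i ≡ just c → ∃ λ M → lookup ϑ i ≡ just M × erase []ᵉ σa M ≡ c
lookup-eraseE⁻¹ σa (just M ∷ ϑ)  zero    refl = M , refl , refl
lookup-eraseE⁻¹ σa (just _ ∷ ϑ)  (suc i) e    = lookup-eraseE⁻¹ σa ϑ i e
lookup-eraseE⁻¹ σa (nothing ∷ ϑ) (suc i) e    = lookup-eraseE⁻¹ σa ϑ i e

byLabel-just-inv : ∀ {X : Set} (θ : Map X) ψ (κ : X → Maybe X) {R} → byLabel θ ψ κ ≡ just R
  → (∃ λ c → θ !! ψ ≡ just c × κ c ≡ just R) ⊎ θ !! ℓd ≡ just R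
byLabel-just-inv θ ψ κ e with θ !! ψ
... | just c  = inj₁ (c , refl , e)
... | nothing = inj₂ e

ap1T-just-inv : ∀ {n m} (f : Term n m) x {R} → ap1T f x ≡ just R → ∃ λ a → x ≡ just a × R ≡ app f a
ap1T-just-inv f (just a) refl = a , refl , refl

ap2T-just-inv : ∀ {n m} (f : Term n m) x y {R} → ap2T f x y ≡ just R
  → ∃ λ a → ∃ λ b → x ≡ just a × y ≡ just b × R ≡ app (app f a) b
ap2T-just-inv f (just a) (just b) refl = a , b , refl , refl , refl

module _ {m} (σa : Fin m → Λ k₁) (ϑ : Map (Term 0 m)) where

  private
    ErasesToCombination : Term 0 m → Set
    ErasesToCombination R = Combination (eraseE σa ϑ) (erase []ᵉ σa R)

    default : ∀ {R} → ϑ !! ℓd ≡ just R → ErasesToCombination R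
    default e = leaf d-nullary (lookup-eraseE σa ϑ (ix ℓd) e)

    nullary : ∀ {ψ R} → Nullary ψ → byLabel ϑ ψ just ≡ just R → ErasesToCombination R
    nullary {ψ} n e with byLabel-just-inv ϑ ψ just e
    ... | inj₁ (c , e₁ , refl) = leaf n (lookup-eraseE σa ϑ (ix ψ) e₁)
    ... | inj₂ e₁              = default e₁

  mutual
    applyTm-Combination : ∀ {n k'} (q : Trail n k') → ∀ {R} → applyTm q ϑ ≡ just R
      → ErasesToCombination R
    applyTm-Combination (trefl _)      = nullary refl-nullary
    applyTm-Combination (tβ _ _ _)     = nullary β-nullary
    applyTm-Combination (tβ□ _ _ _)    = nullary β□-nullary
    applyTm-Combination (tti _ _)      = nullary ti-nullary
    applyTm-Combination (ttrans q q')  = binary trans-binary q q'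
    applyTm-Combination (tapp q q')    = binary app-binary q q'
    applyTm-Combination (tlet q _ q')  = binary let-binary q q'
    applyTm-Combination (ttrpl ζ)      = applyZTm-Combination ζ
    applyTm-Combination (tlam _ q) e with byLabel-just-inv ϑ ℓlam _ e
    ... | inj₂ e₁ = default e₁
    ... | inj₁ (c , e₁ , e₂) with ap1T-just-inv c (applyTm q ϑ) e₂
    ... | a , ea , refl = node1 (lookup-eraseE σa ϑ (ix ℓlam) e₁) (applyTm-Combination q ea)

    binary : ∀ {n k₂ k₃ ψ} → Binary ψ → (q : Trail n k₂) (q' : Trail n k₃) → ∀ {R}
      → byLabel ϑ ψ (λ c → ap2T c (applyTm q ϑ) (applyTm q' ϑ)) ≡ just R → ErasesToCombination R
    binary {ψ = ψ} b q q' e with byLabel-just-inv ϑ ψ _ e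
    ... | inj₂ e₁ = default e₁
    ... | inj₁ (c , e₁ , e₂) with ap2T-just-inv c (applyTm q ϑ) (applyTm q' ϑ) e₂
    ... | a , a' , ea , ea' , refl =
      node2 b (lookup-eraseE σa ϑ (ix ψ) e₁) (applyTm-Combination q ea) (applyTm-Combination q' ea')

    applyZTm-Combination : ∀ {k'} (ζ : Vec (Maybe (Trail 0 k')) j) → ∀ {R}
      → applyZTm ζ ϑ ≡ just R → ErasesToCombination R
    applyZTm-Combination []            = nullary trpl[]-nullary
    applyZTm-Combination (nothing ∷ ζ) = applyZTm-Combination ζ
    applyZTm-Combination (just q ∷ ζ) e with byLabel-just-inv ϑ ℓtrpl∷ _ e
    ... | inj₂ e₁ = default e₁
    ... | inj₁ (c , e₁ , e₂) with ap2T-just-inv c (applyTm q ϑ) (applyZTm ζ ϑ) e₂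
    ... | a , a' , ea , ea' , refl =
      node2 trpl∷-binary (lookup-eraseE σa ϑ (ix ℓtrpl∷) e₁)
        (applyTm-Combination q ea) (applyZTm-Combination ζ ea')

eraseE-≔-⇝E : ∀ {m} (σa : Fin m → Λ k₁) (ϑ : Vec (Maybe (Term 0 m)) j) (i : Fin j) {X Y : Term 0 m}
  → erase []ᵉ σa X ⇝ erase []ᵉ σa Y
  → eraseE σa (ϑ [ i ]≔ just X) ⇝E eraseE σa (ϑ [ i ]≔ just Y)
eraseE-≔-⇝E σa (_ ∷ ϑ)       zero    s = here s
eraseE-≔-⇝E σa (nothing ∷ ϑ) (suc i) s = there (eraseE-≔-⇝E σa ϑ i s)
eraseE-≔-⇝E σa (just _ ∷ ϑ)  (suc i) s = there (eraseE-≔-⇝E σa ϑ i s)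

ErasureStep : ∀ {n m} → Term n m → Term n m → Set
ErasureStep {n} {m} X Y =
  ∀ {k} (σs : Fin n → Λ k) (σa : Fin m → Λ k) → erase σs σa X ⇝ erase σs σa Y

erase-plug-⇝ : ∀ {n m n' m'} (F : BFCtx n m n' m') {X Y : Term n' m'}
  → ErasureStep X Y → ErasureStep (plug F X) (plug F Y)
erase-plug-⇝ hole         h σs σa = h σs σa
erase-plug-⇝ (lamF A F)   h σs σa = ƛ-cong (erase-plug-⇝ F h _ _)
erase-plug-⇝ (appL F N)   h σs σa = ·-congˡ (erase-plug-⇝ F h _ _)
erase-plug-⇝ (appR N F)   h σs σa = ·-congʳ (erase-plug-⇝ F h _ _)
erase-plug-⇝ (letL A F N) h σs σa = ·-congʳ (erase-plug-⇝ F h _ _)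
erase-plug-⇝ (letR A N F) h σs σa = ·-congˡ (ƛ-cong (erase-plug-⇝ F h _ _))
erase-plug-⇝ (tiF ϑ ψ F)  h σs σa = τ-cong (eraseE-≔-⇝E σa ϑ (ix ψ) (erase-plug-⇝ F h []ᵉ σa))

erase-⟶ : ∀ {n m} {M N : Term n m} → M ⟶ N → ErasureStep M N
erase-⟶ (r-β q F A M N) _ σa = erase-plug-⇝ F β-step []ᵉ σa
  where
  β-step : ErasureStep (app (lam A M) N) (M [ N /a]ᵐ)
  β-step σs σa = subst (erase σs σa (app (lam A M) N) ⇝_) (sym (erase-[/a] σs σa M N)) β
erase-⟶ (r-β□ q F A q' M N) _ σa = erase-plug-⇝ F β□-step []ᵉ σa
  where
  β□-step : ErasureStep (mlet A (box q' M) N) (N ⋉ sgδ M q' (src q'))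
  β□-step σs σa =
    subst (erase σs σa (mlet A (box q' M) N) ⇝_) (sym (erase-⋉-sgδ σs σa N M q' (src q'))) β
erase-⟶ (r-ti q F ϑ R e) _ σa = erase-plug-⇝ F ti-step []ᵉ σa
  where
  ti-step : ErasureStep (TI ϑ) (wk0Tm R)
  ti-step σs σa = τ-ti (subst (Combination _)
                               (sym (trans (erase-renTm σs σa (λ ()) id R) (erase-closed _ _ R)))
                               (applyTm-Combination σa ϑ (renTr id (ctxRenA F) q) e))
erase-⟶ (r-cong q F s) _ σa = erase-plug-⇝ F (erase-⟶ s) []ᵉ σa

eraseTy : ∀ {m} → Type m → Ty
eraseTy (atom _)  = ι
eraseTy (A ⊃ B)   = eraseTy A ⇒ eraseTy B
eraseTy (⟦ _ ⟧ A) = eraseTy A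

eraseTy-renT : ∀ {m m'} (ρ : Fin m → Fin m') (A : Type m) → eraseTy (renT ρ A) ≡ eraseTy A
eraseTy-renT ρ (atom _)  = refl
eraseTy-renT ρ (A ⊃ B)   = cong₂ _⇒_ (eraseTy-renT ρ A) (eraseTy-renT ρ B)
eraseTy-renT ρ (⟦ _ ⟧ A) = eraseTy-renT ρ A

eraseTy-subT : ∀ {m m'} (σ : Fin m → Code 0 m') (A : Type m) → eraseTy (subT σ A) ≡ eraseTy A
eraseTy-subT σ (atom _)  = refl
eraseTy-subT σ (A ⊃ B)   = cong₂ _⇒_ (eraseTy-subT σ A) (eraseTy-subT σ B)
eraseTy-subT σ (⟦ _ ⟧ A) = eraseTy-subT σ A

eraseTy-T : ∀ {m} (B : Type m) ψ → eraseTy (T B ψ) ≡ arity (eraseTy B) ψ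
eraseTy-T B ℓrefl   = refl
eraseTy-T B ℓtrans  = refl
eraseTy-T B ℓβ      = refl
eraseTy-T B ℓβ□     = refl
eraseTy-T B ℓti     = refl
eraseTy-T B ℓlam    = refl
eraseTy-T B ℓapp    = refl
eraseTy-T B ℓlet    = refl
eraseTy-T B ℓtrpl[] = refl
eraseTy-T B ℓtrpl∷  = refl
eraseTy-T B ℓd      = refl

RedEnv : ∀ {m} → Vec (Type m) j → (Fin j → Λ k₁) → Set
RedEnv Γ σ = ∀ i → Red (eraseTy (lookup Γ i)) (σ i)

RedEnv-wkCtx : ∀ {m} (Γ : Vec (Type m) j) {σ : Fin j → Λ k₁} → RedEnv Γ σ → RedEnv (wkCtx Γ) σ
RedEnv-wkCtx Γ {σ} r i =
  subst (λ X → Red X (σ i))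
        (sym (trans (cong eraseTy (lookup-map i (renT suc) Γ)) (eraseTy-renT suc (lookup Γ i))))
        (r i)

RedEnv-∷ : ∀ {m} {Γ : Vec (Type m) j} {A σ} {v : Λ k₁} → Red (eraseTy A) v → RedEnv Γ σ
  → RedEnv (A ∷ Γ) (v ∷ᵉ σ)
RedEnv-∷ rv r zero    = rv
RedEnv-∷ rv r (suc i) = r i

mutual
  fundamental : ∀ {n m} {Δ : Vec (Type m) m} {Γ : Vec (Type m) n} {M A s} → Δ ⨾ Γ ⊢ M ∶ A ∣ s
    → (σs : Fin n → Λ k₁) (σa : Fin m → Λ k₁) → RedEnv Γ σs → RedEnv Δ σa
    → Red (eraseTy A) (erase σs σa M)
  fundamental (m-var i)  σs σa rs ra = rs i
  fundamental (m-uvar i) σs σa rs ra = ra i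
  fundamental (m-lam {A = A} {B} {M} ⊢M) σs σa rs ra u ru = Red-β (eraseTy A) (eraseTy B) body ru
    where
    body : ∀ v → Red (eraseTy A) v → Red (eraseTy B) (erase (lift σs) (wk ∘ σa) M [ v ]₀)
    body v rv = subst (Red (eraseTy B)) (sym (erase-lift-[]₀ σs σa M v))
                      (fundamental ⊢M (v ∷ᵉ σs) σa (RedEnv-∷ rv rs) ra)
  fundamental (m-app ⊢M ⊢N) σs σa rs ra =
    fundamental ⊢M σs σa rs ra _ (fundamental ⊢N σs σa rs ra)
  fundamental (m-box ⊢M _) σs σa rs ra = fundamental ⊢M []ᵉ σa (λ ()) ra
  fundamental {Δ = Δ} {Γ} (m-let {A = A} {C} {r} {M} {N} ⊢M ⊢N) σs σa rs ra =
    subst (λ X → Red X _) (sym (eraseTy-subT (sgA r) C))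
          (Red-β (eraseTy A) (eraseTy C) body (fundamental ⊢M σs σa rs ra))
    where
    body : ∀ v → Red (eraseTy A) v → Red (eraseTy C) (erase (wk ∘ σs) (lift σa) N [ v ]₀)
    body v rv = subst (Red (eraseTy C)) (sym (erase-liftᵃ-[]₀ σs σa N v))
                      (fundamental ⊢N σs (v ∷ᵉ σa) (RedEnv-wkCtx Γ rs)
                         (RedEnv-∷ (subst (λ X → Red X v) (sym (eraseTy-renT suc A)) rv)
                                   (RedEnv-wkCtx Δ ra)))
  fundamental (m-TI {B = B} {ϑ} {θ} _ ⊢ϑ) σs σa rs ra = Red-τ (eraseTy B) entries-Red
    where
    entries-Red : EntriesRed (eraseTy B) (eraseE σa ϑ)
    entries-Red ψ c e with lookup-eraseE⁻¹ σa ϑ (ix ψ) e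
    ... | M , eM , refl = entry-Red {ϑ = ϑ} {θ} ψ eM (⊢ϑ ψ) σa ra

  entry-Red : ∀ {m} {Δ : Vec (Type m) m} {B : Type m} {ϑ : Map (Term 0 m)} {θ : Map (Code 0 m)}
    ψ {M}
    → ϑ !! ψ ≡ just M
    → (ϑ !! ψ ≡ nothing × θ !! ψ ≡ nothing)
      ⊎ (∃ λ M' → ∃ λ s → ϑ !! ψ ≡ just M' × θ !! ψ ≡ just s × Δ ⨾ [] ⊢ M' ∶ T B ψ ∣ s)
    → (σa : Fin m → Λ k₁) → RedEnv Δ σa
    → Red (arity (eraseTy B) ψ) (erase []ᵉ σa M)
  entry-Red ψ eM (inj₁ (e , _)) σa ra with trans (sym e) eM
  ... | ()
  entry-Red {B = B} ψ eM (inj₂ (_ , _ , e , _ , ⊢M)) σa ra with trans (sym e) eM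
  ... | refl = subst (λ X → Red X _) (eraseTy-T B ψ) (fundamental ⊢M []ᵉ σa (λ ()) ra)

mainTheorem4 : ∀ {n m} (Δ : Vec (Type m) m) (Γ : Vec (Type m) n)
    (M : Term n m) (A : Type m) (s : Code n m)
    → Δ ⨾ Γ ⊢ M ∶ A ∣ s
    → ¬ (Σ (ℕ → Term n m) (λ f → f 0 ≡ M × (∀ i → f i ⟶ f (suc i))))
mainTheorem4 {n} {m} Δ Γ M A s ⊢M (f , f0≡M , steps) =
  Acc⇒¬InfiniteDescent (⌊_⌋ ∘ f) SN⌊M⌋ (cong ⌊_⌋ f0≡M , λ i → erase-⟶ (steps i) ★s ★s)
  where
  ★s : ∀ {j} → Fin j → Λ 0
  ★s _ = ★

  ⌊_⌋ : Term n m → Λ 0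
  ⌊_⌋ = erase ★s ★s

  SN⌊M⌋ : SN ⌊ M ⌋
  SN⌊M⌋ = Red⇒SN (eraseTy A) (fundamental ⊢M ★s ★s (λ _ → ★-Red _) (λ _ → ★-Red _))
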